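{- For the uniform case of decremental sets, the algorithm UniRand, which at each step (if some item is pending) collects one of the pending items chosen uniformly at random, is $\mathrm{e}/(\mathrm{e}-1)$-competitive against an oblivious adversary.
   Context: Dynamic set problem: items with weights; time proceeds in steps; before each step items may be inserted into or deleted from a dynamic set $\mathcal{S}$; an item is active if inserted and not yet deleted; at each step an algorithm may collect at most one active item it has not collected before (such items are pending); the gain is the total weight collected. Uniform case: all items have weight $1$. Decremental: all items are inserted before the first step, afterwards only deletions occur. A randomized online algorithm is $R$-competitive against an oblivious adversary if for every instance $I$ (fixed in advance) its expected gain is at least $\mathrm{OPT}(I)/R$, where $\mathrm{OPT}(I)$ is the maximum achievable gain on $I$. -}

module Defs where

open import Data.Bool using (Bool; true; false; T)
open import Data.Nat as ℕ using (ℕ; zero; suc; _<ᵇ_; _!)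
open import Data.Nat.Properties using (_!≢0)
open import Data.Fin using (Fin; _≟_)
open import Data.List using (allFin; List; []; _∷_; length; map; foldr; filter; filterᵇ; catMaybes)
open import Data.List.Relation.Unary.Unique.Propositional using (Unique)
open import Data.Maybe using (Maybe; just; nothing)
open import Data.Product using (_×_)
open import Data.Unit using (⊤)
open import Data.Integer using (+_)
open import Data.Rational using (ℚ; 0ℚ; 1ℚ; _+_; _*_; _-_; _≤_; _/_)
open import Relation.Nullary using (¬?)
open import Data.Fin using () renaming (_≟_ to _≟ᶠ_)

-- An instance with n items (items = Fin n, all of weight 1, all inserted
-- before step 1) is given by `del : Fin n → Maybe ℕ`:
--   del i = nothing  : item i is never deleted;
--   del i = just s   : item i is deleted right before step s
--                      (so it is active exactly at the steps t with t < s).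
-- Steps are numbered 1, 2, 3, ...

DecInstance : ℕ → Set
DecInstance n = Fin n → Maybe ℕ

active : ∀ {n} → DecInstance n → ℕ → Fin n → Bool
active del t i with del i
... | nothing = true
... | just s  = t <ᵇ s

sumℚ : List ℚ → ℚ
sumℚ = foldr _+_ 0ℚ

removeItem : ∀ {n} → Fin n → List (Fin n) → List (Fin n)
removeItem i = filter (λ j → ¬? (i ≟ᶠ j))

-- Expected gain of UniRand from step t on, when S is the list of items not
-- yet collected (fuel bounds the number of remaining collections).  If none is pending then
-- (decremental case) none will ever be pending again and the gain is 0;
-- otherwise UniRand collects one pending item chosen uniformly at random.
uniRandFrom : ∀ {n} → DecInstance n → (fuel t : ℕ) → List (Fin n) → ℚ
uniRandFrom del zero t S = 0ℚ
uniRandFrom del (suc f) t S with filterᵇ (active del t) S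
... | [] = 0ℚ
... | x ∷ xs =
  1ℚ + (+ 1 / suc (length xs))
       * sumℚ (map (λ i → uniRandFrom del f (suc t) (removeItem i S)) (x ∷ xs))

-- Expected gain of UniRand on the instance (n collections suffice,
-- since there are only n items).
uniRandExpectedGain : ∀ {n} → DecInstance n → ℚ
uniRandExpectedGain {n} del = uniRandFrom del n 1 (allFin n)

-- Offline solutions: a schedule lists, for steps 1, 2, ..., the item
-- collected at that step (or nothing).

ActiveSchedFrom : ∀ {n} → DecInstance n → ℕ → List (Maybe (Fin n)) → Set
ActiveSchedFrom del t [] = ⊤
ActiveSchedFrom del t (nothing ∷ σ) = ActiveSchedFrom del (suc t) σ
ActiveSchedFrom del t (just i ∷ σ) = T (active del t i) × ActiveSchedFrom del (suc t) σ

Feasible : ∀ {n} → DecInstance n → List (Maybe (Fin n)) → Set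
Feasible del σ = ActiveSchedFrom del 1 σ × Unique (catMaybes σ)

gain : ∀ {n} → List (Maybe (Fin n)) → ℕ
gain σ = length (catMaybes σ)

-- The constant e, through its partial sums  eApprox N = Σ_{k=0}^{N} 1/k!,
-- which increase to e.

eApprox : ℕ → ℚ
eApprox zero = 1ℚ
eApprox (suc N) = eApprox N + (+ 1 / (suc N) !)
  where instance _ = (suc N) !≢0

-- `AtLeastOverEOverEMinus1 E opt` means  E ≥ opt / (e/(e-1)) = opt·(1 - 1/e).
-- Since eApprox N ↑ e, this holds iff (opt - E)·e ≤ opt, iff
-- (opt - E)·eApprox N ≤ opt for every N.
AtLeastOverEOverEMinus1 : ℚ → ℚ → Set
AtLeastOverEOverEMinus1 E opt = ∀ N → (opt - E) * eApprox N ≤ opt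

ℕtoℚ : ℕ → ℚ
ℕtoℚ m = + m / 1

-- UniRand can be simulated by a uniformly random order of all items: scan the order and collect an item
-- whenever it is still alive at the current step. An item that is dead when reached stays dead, so the first
-- live item is uniform among the pending ones, and n! times the expected gain is the total greedy gain over
-- all n! orders. The average greedy gain only grows when items are added or lifetimes lengthened, and an
-- offline solution collecting g items shows that the lifetimes of those items dominate 1, 2, …, g. Hence
-- UniRand gains at least the mean greedy gain a_g on this staircase instance. Fixing the value at a given
-- position of the order yields a recursion for a_g, whose solution gives g − a_g = Σ_{m=1}^{g} d_m with d_m =
-- Σ_{i≤m} (-1)^i/i!. Finally e_N · d_m ≤ 1 and e_N · (d_m + d_{m+1}) ≤ 2 for odd m, so e_N · (g − a_g) ≤ g for
-- every N.

module Submission where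

open import Defs
open import Data.Nat using (ℕ)
open import Data.Fin using (Fin)
open import Data.List using (List)
open import Data.Maybe using (Maybe)


module RangeSums where

  open import Data.Nat
  open import Data.Nat.Properties using (+-comm; +-assoc)
  open import Relation.Binary.PropositionalEquality

  sumTo : ℕ → (ℕ → ℕ) → ℕ
  sumTo zero g = 0
  sumTo (suc n) g = g 0 + sumTo n (λ i → g (suc i))

  sumTo-cong-< : ∀ n (g h : ℕ → ℕ) → (∀ i → i < n → g i ≡ h i) → sumTo n g ≡ sumTo n h
  sumTo-cong-< zero g h e = refl
  sumTo-cong-< (suc n) g h e = cong₂ _+_ (e 0 z<s) (sumTo-cong-< n _ _ (λ i lt → e (suc i) (s<s lt)))

  sumTo-cong : ∀ n (g h : ℕ → ℕ) → (∀ i → g i ≡ h i) → sumTo n g ≡ sumTo n h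
  sumTo-cong n g h e = sumTo-cong-< n g h (λ i _ → e i)

  sumTo-zero : ∀ n → sumTo n (λ _ → 0) ≡ 0
  sumTo-zero zero = refl
  sumTo-zero (suc n) = sumTo-zero n

  sumTo-one : ∀ n → sumTo n (λ _ → 1) ≡ n
  sumTo-one zero = refl
  sumTo-one (suc n) = cong suc (sumTo-one n)

  sumTo-last : ∀ n (g : ℕ → ℕ) → sumTo (suc n) g ≡ sumTo n g + g n
  sumTo-last zero g = +-comm (g 0) 0
  sumTo-last (suc n) g = trans (cong (g 0 +_) (sumTo-last n (λ i → g (suc i)))) (sym (+-assoc (g 0) _ _))


module PermutationSums where

  open import Data.Nat
  open import Data.Nat.Properties
  open import Data.List using (List; []; _∷_; length; map)
  open import Data.List.Relation.Unary.All using (All; []; _∷_; universal-U)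
  open import Data.List.Relation.Binary.Pointwise using (Pointwise; []; _∷_)
  open import Relation.Unary using (U)
  open import Relation.Binary.PropositionalEquality
  import Data.List.Relation.Binary.Permutation.Propositional as Perm
  open Perm using (_↭_)
  open import Algebra.Properties.CommutativeSemigroup +-commutativeSemigroup using (interchange; x∙yz≈y∙xz)
  open import Data.Nat.Solver using (module +-*-Solver)
  open +-*-Solver using (solve; _:+_; _:=_)
  open RangeSums

  -- sumPicks f R sums f x R′ over the ways of splitting R into one entry x and the rest R′ (up to order);
  -- sumInserts x G σ sums G over the length σ + 1 ways of inserting x into σ;
  -- sumPerms G R sums G over the (length R)! orderings of R, built by inserting the entries one by one.
  sumPicks : {A : Set} → (A → List A → ℕ) → List A → ℕ
  sumPicks f [] = 0
  sumPicks f (x ∷ xs) = f x xs + sumPicks (λ y ys → f y (x ∷ ys)) xs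

  sumInserts : {A : Set} → A → (List A → ℕ) → List A → ℕ
  sumInserts x G [] = G (x ∷ [])
  sumInserts x G (y ∷ σ) = G (x ∷ y ∷ σ) + sumInserts x (λ τ → G (y ∷ τ)) σ

  sumPerms : {A : Set} → (List A → ℕ) → List A → ℕ
  sumPerms G [] = G []
  sumPerms G (x ∷ xs) = sumPerms (sumInserts x G) xs

  module _ {A : Set} where

    sumPicks-+ : ∀ (f g : A → List A → ℕ) R → sumPicks (λ y ys → f y ys + g y ys) R ≡ sumPicks f R + sumPicks g R
    sumPicks-+ f g [] = refl
    sumPicks-+ f g (x ∷ xs) = trans (cong ((f x xs + g x xs) +_) (sumPicks-+ _ _ xs)) (interchange (f x xs) (g x xs) _ _)

    sumInserts-cong : ∀ x (G H : List A → ℕ) → (∀ τ → G τ ≡ H τ) → ∀ σ → sumInserts x G σ ≡ sumInserts x H σ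
    sumInserts-cong x G H h [] = h _
    sumInserts-cong x G H h (y ∷ σ) = cong₂ _+_ (h _) (sumInserts-cong x _ _ (λ τ → h (y ∷ τ)) σ)

    sumPerms-cong : ∀ (G H : List A → ℕ) → (∀ τ → G τ ≡ H τ) → ∀ R → sumPerms G R ≡ sumPerms H R
    sumPerms-cong G H h [] = h []
    sumPerms-cong G H h (x ∷ xs) = sumPerms-cong _ _ (sumInserts-cong x G H h) xs

    sumInserts-+ : ∀ x (G H : List A → ℕ) σ → sumInserts x (λ τ → G τ + H τ) σ ≡ sumInserts x G σ + sumInserts x H σ
    sumInserts-+ x G H [] = refl
    sumInserts-+ x G H (y ∷ σ) = trans (cong ((G (x ∷ y ∷ σ) + H (x ∷ y ∷ σ)) +_) (sumInserts-+ x (λ τ → G (y ∷ τ)) (λ τ → H (y ∷ τ)) σ)) (interchange (G (x ∷ y ∷ σ)) (H (x ∷ y ∷ σ)) (sumInserts x (λ τ → G (y ∷ τ)) σ) (sumInserts x (λ τ → H (y ∷ τ)) σ))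

    sumPerms-+ : ∀ (G H : List A → ℕ) R → sumPerms (λ τ → G τ + H τ) R ≡ sumPerms G R + sumPerms H R
    sumPerms-+ G H [] = refl
    sumPerms-+ G H (x ∷ xs) = trans (sumPerms-cong _ _ (sumInserts-+ x G H) xs) (sumPerms-+ (sumInserts x G) (sumInserts x H) xs)

    sumInserts-* : ∀ k x (G : List A → ℕ) σ → sumInserts x (λ τ → k * G τ) σ ≡ k * sumInserts x G σ
    sumInserts-* k x G [] = refl
    sumInserts-* k x G (y ∷ σ) = trans (cong (k * G (x ∷ y ∷ σ) +_) (sumInserts-* k x (λ τ → G (y ∷ τ)) σ)) (sym (*-distribˡ-+ k _ _))

    sumPerms-* : ∀ k (G : List A → ℕ) R → sumPerms (λ τ → k * G τ) R ≡ k * sumPerms G R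
    sumPerms-* k G [] = refl
    sumPerms-* k G (x ∷ xs) = trans (sumPerms-cong _ _ (sumInserts-* k x G) xs) (sumPerms-* k (sumInserts x G) xs)

    sumInserts-cong-All : (P : A → Set) → ∀ x (G H : List A → ℕ) σ → P x → All P σ →
      (∀ τ → length τ ≡ suc (length σ) → All P τ → G τ ≡ H τ) → sumInserts x G σ ≡ sumInserts x H σ
    sumInserts-cong-All P x G H [] px pσ h = h _ refl (px ∷ [])
    sumInserts-cong-All P x G H (y ∷ σ) px (py ∷ pσ) h =
      cong₂ _+_ (h _ refl (px ∷ py ∷ pσ))
        (sumInserts-cong-All P x (λ τ → G (y ∷ τ)) (λ τ → H (y ∷ τ)) σ px pσ (λ τ eq pτ → h (y ∷ τ) (cong suc eq) (py ∷ pτ)))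

    sumPerms-cong-All : (P : A → Set) → ∀ (G H : List A → ℕ) R → All P R →
      (∀ τ → length τ ≡ length R → All P τ → G τ ≡ H τ) → sumPerms G R ≡ sumPerms H R
    sumPerms-cong-All P G H [] pR h = h [] refl []
    sumPerms-cong-All P G H (x ∷ xs) (px ∷ pxs) h =
      sumPerms-cong-All P (sumInserts x G) (sumInserts x H) xs pxs (λ τ eq pτ → sumInserts-cong-All P x G H τ px pτ
        (λ τ' eq' pτ' → h τ' (trans eq' (cong suc eq)) pτ'))

    sumInserts-mono-All : (P : A → Set) → ∀ x (G H : List A → ℕ) σ → P x → All P σ →
      (∀ τ → length τ ≡ suc (length σ) → All P τ → G τ ≤ H τ) → sumInserts x G σ ≤ sumInserts x H σ
    sumInserts-mono-All P x G H [] px pσ h = h _ refl (px ∷ [])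
    sumInserts-mono-All P x G H (y ∷ σ) px (py ∷ pσ) h =
      +-mono-≤ (h _ refl (px ∷ py ∷ pσ))
        (sumInserts-mono-All P x (λ τ → G (y ∷ τ)) (λ τ → H (y ∷ τ)) σ px pσ (λ τ eq pτ → h (y ∷ τ) (cong suc eq) (py ∷ pτ)))

    sumPerms-mono-All : (P : A → Set) → ∀ (G H : List A → ℕ) R → All P R →
      (∀ τ → length τ ≡ length R → All P τ → G τ ≤ H τ) → sumPerms G R ≤ sumPerms H R
    sumPerms-mono-All P G H [] pR h = h [] refl []
    sumPerms-mono-All P G H (x ∷ xs) (px ∷ pxs) h =
      sumPerms-mono-All P (sumInserts x G) (sumInserts x H) xs pxs (λ τ eq pτ → sumInserts-mono-All P x G H τ px pτ
        (λ τ' eq' pτ' → h τ' (trans eq' (cong suc eq)) pτ'))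

    sumInserts-length : ∀ (x : A) (F : ℕ → ℕ) σ → sumInserts x (λ τ → F (length τ)) σ ≡ suc (length σ) * F (suc (length σ))
    sumInserts-length x F [] = sym (+-identityʳ _)
    sumInserts-length x F (y ∷ σ) = cong (F (suc (suc (length σ))) +_) (sumInserts-length x (λ n → F (suc n)) σ)

    sumPerms-length : ∀ (F : ℕ → ℕ) (R : List A) → sumPerms (λ τ → F (length τ)) R ≡ length R ! * F (length R)
    sumPerms-length F [] = sym (+-identityʳ _)
    sumPerms-length F (x ∷ xs) = begin
        sumPerms (sumInserts x (λ τ → F (length τ))) xs
      ≡⟨ sumPerms-cong (sumInserts x (λ τ → F (length τ))) (λ τ → suc (length τ) * F (suc (length τ))) (sumInserts-length x F) xs ⟩
        sumPerms (λ τ → suc (length τ) * F (suc (length τ))) xs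
      ≡⟨ sumPerms-length (λ n → suc n * F (suc n)) xs ⟩
        length xs ! * (suc (length xs) * F (suc (length xs)))
      ≡⟨ sym (*-assoc (length xs !) _ _) ⟩
        length xs ! * suc (length xs) * F (suc (length xs))
      ≡⟨ cong (_* F (suc (length xs))) (*-comm (length xs !) (suc (length xs))) ⟩
        suc (length xs) * length xs ! * F (suc (length xs))
      ∎
      where open ≡-Reasoning

    sumPerms-const : ∀ c (R : List A) → sumPerms (λ _ → c) R ≡ length R ! * c
    sumPerms-const c R = sumPerms-length (λ _ → c) R

    sumInserts-comm : ∀ (x y : A) G σ → sumInserts x (sumInserts y G) σ ≡ sumInserts y (sumInserts x G) σ
    sumInserts-comm x y G [] = +-comm (G (y ∷ x ∷ [])) (G (x ∷ y ∷ []))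
    sumInserts-comm x y G (z ∷ σ) = begin
        sumInserts y G (x ∷ z ∷ σ) + sumInserts x (λ τ → sumInserts y G (z ∷ τ)) σ
      ≡⟨ cong (sumInserts y G (x ∷ z ∷ σ) +_) (sumInserts-+ x (λ τ → G (y ∷ z ∷ τ)) (sumInserts y Gz) σ) ⟩
        (Gyx + (Gxy + sumInserts y (λ τ → G (x ∷ z ∷ τ)) σ))
          + (sumInserts x (λ τ → G (y ∷ z ∷ τ)) σ + sumInserts x (sumInserts y Gz) σ)
      ≡⟨ cong (λ w → (Gyx + (Gxy + sumInserts y (λ τ → G (x ∷ z ∷ τ)) σ)) + (sumInserts x (λ τ → G (y ∷ z ∷ τ)) σ + w))
           (sumInserts-comm x y Gz σ) ⟩
        (Gyx + (Gxy + sumInserts y (λ τ → G (x ∷ z ∷ τ)) σ))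
          + (sumInserts x (λ τ → G (y ∷ z ∷ τ)) σ + sumInserts y (sumInserts x Gz) σ)
      ≡⟨ rearrange Gyx Gxy (sumInserts y (λ τ → G (x ∷ z ∷ τ)) σ) (sumInserts x (λ τ → G (y ∷ z ∷ τ)) σ) _ ⟩
        (Gxy + (Gyx + sumInserts x (λ τ → G (y ∷ z ∷ τ)) σ))
          + (sumInserts y (λ τ → G (x ∷ z ∷ τ)) σ + sumInserts y (sumInserts x Gz) σ)
      ≡⟨ cong (sumInserts x G (y ∷ z ∷ σ) +_) (sym (sumInserts-+ y (λ τ → G (x ∷ z ∷ τ)) (sumInserts x Gz) σ)) ⟩
        sumInserts x G (y ∷ z ∷ σ) + sumInserts y (λ τ → sumInserts x G (z ∷ τ)) σ
      ∎
      where
      open ≡-Reasoning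
      Gz : List A → ℕ
      Gz τ = G (z ∷ τ)
      Gxy = G (x ∷ y ∷ z ∷ σ)
      Gyx = G (y ∷ x ∷ z ∷ σ)
      rearrange : ∀ a b c d e → (a + (b + c)) + (d + e) ≡ (b + (a + d)) + (c + e)
      rearrange = solve 5 (λ a b c d e → (a :+ (b :+ c)) :+ (d :+ e) := (b :+ (a :+ d)) :+ (c :+ e)) refl

    sumPerms-↭ : ∀ (G : List A → ℕ) {R R'} → R ↭ R' → sumPerms G R ≡ sumPerms G R'
    sumPerms-↭ G Perm.refl = refl
    sumPerms-↭ G (Perm.prep x p) = sumPerms-↭ (sumInserts x G) p
    sumPerms-↭ G (Perm.swap {xs} {ys} x y p) =
      trans (sumPerms-↭ (sumInserts y (sumInserts x G)) p) (sumPerms-cong _ _ (sumInserts-comm y x G) ys)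
    sumPerms-↭ G (Perm.trans p q) = trans (sumPerms-↭ G p) (sumPerms-↭ G q)

    sumInsertsBehind : A → (List A → ℕ) → List A → ℕ
    sumInsertsBehind x G [] = 0
    sumInsertsBehind x G (y ∷ σ) = sumInserts x (λ τ → G (y ∷ τ)) σ

    sumInserts-head : ∀ x (G : List A → ℕ) σ → sumInserts x G σ ≡ G (x ∷ σ) + sumInsertsBehind x G σ
    sumInserts-head x G [] = sym (+-identityʳ _)
    sumInserts-head x G (y ∷ σ) = refl

    sumPerms-byHead : ∀ (G : List A → ℕ) x xs → sumPerms G (x ∷ xs) ≡ sumPicks (λ y ys → sumPerms (λ σ → G (y ∷ σ)) ys) (x ∷ xs)
    sumPerms-byHead G x xs = trans (sumPerms-cong _ _ (sumInserts-head x G) xs)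
      (trans (sumPerms-+ (λ σ → G (x ∷ σ)) (sumInsertsBehind x G) xs) (cong (sumPerms (λ σ → G (x ∷ σ)) xs +_) (behind xs)))
      where
      behind : ∀ xs → sumPerms (sumInsertsBehind x G) xs ≡ sumPicks (λ y ys → sumPerms (λ σ → G (y ∷ σ)) (x ∷ ys)) xs
      behind [] = refl
      behind (z ∷ zs) = sumPerms-byHead (sumInsertsBehind x G) z zs

    sumPicks-exchange : ∀ (K : A → A → List A → ℕ) R →
      sumPicks (λ x Q → sumPicks (λ v Q' → K x v Q') Q) R ≡ sumPicks (λ v Q → sumPicks (λ x Q' → K x v Q') Q) R
    sumPicks-exchange K [] = refl
    sumPicks-exchange K (z ∷ R) = begin
        sumPicks (λ v Q' → K z v Q') R + sumPicks (λ x ys → sumPicks (λ v Q' → K x v Q') (z ∷ ys)) R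
      ≡⟨ cong (sumPicks (λ v Q' → K z v Q') R +_) (sumPicks-+ (λ x ys → K x z ys) (λ x ys → sumPicks (λ v Q' → K x v (z ∷ Q')) ys) R) ⟩
        sumPicks (λ v Q' → K z v Q') R + (sumPicks (λ x ys → K x z ys) R + sumPicks (λ x ys → sumPicks (λ v Q' → K x v (z ∷ Q')) ys) R)
      ≡⟨ cong (λ w → sumPicks (λ v Q' → K z v Q') R + (sumPicks (λ x ys → K x z ys) R + w)) (sumPicks-exchange (λ x v Q' → K x v (z ∷ Q')) R) ⟩
        sumPicks (λ v Q' → K z v Q') R + (sumPicks (λ x ys → K x z ys) R + sumPicks (λ v ys → sumPicks (λ x Q' → K x v (z ∷ Q')) ys) R)
      ≡⟨ x∙yz≈y∙xz (sumPicks (λ v Q' → K z v Q') R) (sumPicks (λ x ys → K x z ys) R) _ ⟩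
        sumPicks (λ x ys → K x z ys) R + (sumPicks (λ v Q' → K z v Q') R + sumPicks (λ v ys → sumPicks (λ x Q' → K x v (z ∷ Q')) ys) R)
      ≡⟨ cong (sumPicks (λ x ys → K x z ys) R +_) (sym (sumPicks-+ (λ v Q' → K z v Q') (λ v ys → sumPicks (λ x Q' → K x v (z ∷ Q')) ys) R)) ⟩
        sumPicks (λ x Q' → K x z Q') R + sumPicks (λ v ys → sumPicks (λ x Q' → K x v Q') (z ∷ ys)) R
      ∎
      where open ≡-Reasoning

    sumPicks-cong-length : ∀ (f g : A → List A → ℕ) n → (∀ y ys → length ys ≡ n → f y ys ≡ g y ys) →
      ∀ R → length R ≡ suc n → sumPicks f R ≡ sumPicks g R
    sumPicks-cong-length f g n h [] ()
    sumPicks-cong-length f g n h (x ∷ []) eq = cong₂ _+_ (h x [] (cong pred eq)) refl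
    sumPicks-cong-length f g zero h (x ∷ x′ ∷ xs) ()
    sumPicks-cong-length f g (suc n) h (x ∷ x′ ∷ xs) eq =
      cong₂ _+_ (h x (x′ ∷ xs) (cong pred eq))
        (sumPicks-cong-length (λ y ys → f y (x ∷ ys)) (λ y ys → g y (x ∷ ys)) n (λ y ys e → h y (x ∷ ys) (cong suc e)) (x′ ∷ xs) (cong pred eq))

    sumPerms-cong-length : ∀ (G H : List A → ℕ) R → (∀ τ → length τ ≡ length R → G τ ≡ H τ) → sumPerms G R ≡ sumPerms H R
    sumPerms-cong-length G H R h = sumPerms-cong-All U G H R (universal-U R) (λ τ e _ → h τ e)

    module _ {_∼_ : A → A → Set} where

      sumInserts-mono-Pointwise : ∀ x x′ (G H : List A → ℕ) {σ σ′} → x ∼ x′ → Pointwise _∼_ σ σ′ →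
        (∀ τ τ′ → Pointwise _∼_ τ τ′ → G τ ≤ H τ′) → sumInserts x G σ ≤ sumInserts x′ H σ′
      sumInserts-mono-Pointwise x x′ G H x∼x′ [] h = h _ _ (x∼x′ ∷ [])
      sumInserts-mono-Pointwise x x′ G H x∼x′ (_∷_ {x = y} {y = y′} y∼y′ σ∼σ′) h =
        +-mono-≤ (h _ _ (x∼x′ ∷ y∼y′ ∷ σ∼σ′))
          (sumInserts-mono-Pointwise x x′ (λ τ → G (y ∷ τ)) (λ τ → H (y′ ∷ τ)) x∼x′ σ∼σ′ (λ τ τ′ q → h _ _ (y∼y′ ∷ q)))

      sumPerms-mono-Pointwise : ∀ (G H : List A → ℕ) {R R′} → Pointwise _∼_ R R′ →
        (∀ τ τ′ → Pointwise _∼_ τ τ′ → G τ ≤ H τ′) → sumPerms G R ≤ sumPerms H R′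
      sumPerms-mono-Pointwise G H [] h = h [] [] []
      sumPerms-mono-Pointwise G H (_∷_ {x = x} {y = x′} x∼x′ R∼R′) h =
        sumPerms-mono-Pointwise (sumInserts x G) (sumInserts x′ H) R∼R′ (λ τ τ′ q → sumInserts-mono-Pointwise x x′ G H x∼x′ q h)

    insertAt : ℕ → A → List A → List A
    insertAt zero v π = v ∷ π
    insertAt (suc j) v [] = v ∷ []
    insertAt (suc j) v (x ∷ π) = x ∷ insertAt j v π

    sumPerms-byPosition : ∀ j (G : List A → ℕ) R → j < length R → sumPerms G R ≡ sumPicks (λ v Q → sumPerms (λ π → G (insertAt j v π)) Q) R
    sumPerms-byPosition zero G (x ∷ xs) lt = sumPerms-byHead G x xs
    sumPerms-byPosition (suc j) G (x ∷ []) (s≤s ())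
    sumPerms-byPosition (suc j) G (x ∷ x′ ∷ xs) (s≤s lt) = begin
        sumPerms G (x ∷ x′ ∷ xs)
      ≡⟨ sumPerms-byHead G x (x′ ∷ xs) ⟩
        sumPicks (λ y ys → sumPerms (λ σ → G (y ∷ σ)) ys) (x ∷ x′ ∷ xs)
      ≡⟨ sumPicks-cong-length _ _ (suc (length xs)) (λ y ys e → sumPerms-byPosition j (λ σ → G (y ∷ σ)) ys (subst (j <_) (sym e) lt)) (x ∷ x′ ∷ xs) refl ⟩
        sumPicks (λ y ys → sumPicks (λ v Q → sumPerms (λ π → G (y ∷ insertAt j v π)) Q) ys) (x ∷ x′ ∷ xs)
      ≡⟨ sumPicks-exchange (λ y v Q → sumPerms (λ π → G (y ∷ insertAt j v π)) Q) (x ∷ x′ ∷ xs) ⟩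
        sumPicks (λ v Q → sumPicks (λ y Q' → sumPerms (λ π → G (y ∷ insertAt j v π)) Q') Q) (x ∷ x′ ∷ xs)
      ≡⟨ sumPicks-cong-length _ _ (suc (length xs)) back (x ∷ x′ ∷ xs) refl ⟩
        sumPicks (λ v Q → sumPerms (λ π → G (insertAt (suc j) v π)) Q) (x ∷ x′ ∷ xs)
      ∎
      where
      open ≡-Reasoning
      back : ∀ v Q → length Q ≡ suc (length xs) →
        sumPicks (λ y Q' → sumPerms (λ π → G (y ∷ insertAt j v π)) Q') Q ≡ sumPerms (λ π → G (insertAt (suc j) v π)) Q
      back v [] ()
      back v (q ∷ qs) e = sym (sumPerms-byHead (λ π → G (insertAt (suc j) v π)) q qs)

    sumPerms-sumTo : ∀ n (G : ℕ → List A → ℕ) R → sumPerms (λ σ → sumTo n (λ i → G i σ)) R ≡ sumTo n (λ i → sumPerms (G i) R)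
    sumPerms-sumTo zero G R = trans (sumPerms-const 0 R) (*-zeroʳ (length R !))
    sumPerms-sumTo (suc n) G R = trans (sumPerms-+ (G 0) (λ σ → sumTo n (λ i → G (suc i) σ)) R)
      (cong (sumPerms (G 0) R +_) (sumPerms-sumTo n (λ i → G (suc i)) R))

  module _ {A B : Set} where
    sumInserts-map : ∀ (f : A → B) (G : List B → ℕ) x σ → sumInserts (f x) G (map f σ) ≡ sumInserts x (λ τ → G (map f τ)) σ
    sumInserts-map f G x [] = refl
    sumInserts-map f G x (y ∷ σ) = cong (G (f x ∷ f y ∷ map f σ) +_) (sumInserts-map f (λ τ → G (f y ∷ τ)) x σ)

    sumPerms-map : ∀ (f : A → B) (G : List B → ℕ) R → sumPerms G (map f R) ≡ sumPerms (λ σ → G (map f σ)) R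
    sumPerms-map f G [] = refl
    sumPerms-map f G (x ∷ xs) = trans (sumPerms-map f (sumInserts (f x) G) xs)
      (sumPerms-cong (λ σ → sumInserts (f x) G (map f σ)) (sumInserts x (λ τ → G (map f τ))) (sumInserts-map f G x) xs)

    sumPicks-map : ∀ (f : A → B) (g : B → List B → ℕ) R → sumPicks g (map f R) ≡ sumPicks (λ y ys → g (f y) (map f ys)) R
    sumPicks-map f g [] = refl
    sumPicks-map f g (x ∷ xs) = cong (g (f x) (map f xs) +_) (sumPicks-map f (λ y ys → g y (f x ∷ ys)) xs)


module Greedy where

  open import Data.Nat
  open import Data.Nat.Properties
  open import Data.List using (List; []; _∷_; length; _++_)
  open import Data.List.Relation.Binary.Pointwise using (Pointwise; []; _∷_)
  open import Relation.Binary.PropositionalEquality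
  open import Data.Bool using (true; false; if_then_else_; T)
  open import Data.Unit using (tt)
  open import Data.Empty using (⊥-elim)
  open import Data.List.Relation.Unary.All using (All; []; _∷_; universal-U)
  open import Relation.Unary using (U)
  open import Algebra.Properties.CommutativeSemigroup *-commutativeSemigroup using (x∙yz≈y∙xz)
  open PermutationSums

  <ᵇ≡true⇒< : ∀ {c l} → (c <ᵇ l) ≡ true → c < l
  <ᵇ≡true⇒< {c} {l} e = <ᵇ⇒< c l (subst T (sym e) tt)

  <ᵇ≡false⇒≥ : ∀ {c l} → (c <ᵇ l) ≡ false → l ≤ c
  <ᵇ≡false⇒≥ {c} {l} e = ≮⇒≥ (λ lt → subst T e (<⇒<ᵇ lt))

  <⇒<ᵇ≡true : ∀ {c l} → c < l → (c <ᵇ l) ≡ true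
  <⇒<ᵇ≡true {c} {l} lt with c <ᵇ l in e
  ... | true = refl
  ... | false = ⊥-elim (<⇒≱ lt (<ᵇ≡false⇒≥ {c} {l} e))

  ≥⇒<ᵇ≡false : ∀ {c l} → l ≤ c → (c <ᵇ l) ≡ false
  ≥⇒<ᵇ≡false {c} {l} le with c <ᵇ l in e
  ... | true = ⊥-elim (<⇒≱ (<ᵇ≡true⇒< {c} {l} e) le)
  ... | false = refl

  -- The greedy scan of a list of lifetimes: with c items collected so far, the next item
  -- (alive exactly during the steps 1 … l) is still alive at step c + 1 iff c < l.
  greedyStep : ℕ → ℕ → ℕ
  greedyStep c l = if c <ᵇ l then suc c else c

  greedy : ℕ → List ℕ → ℕ
  greedy c [] = c
  greedy c (l ∷ σ) = greedy (greedyStep c l) σ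

  greedyStep-≥ : ∀ c l → c ≤ greedyStep c l
  greedyStep-≥ c l with c <ᵇ l
  ... | true = n≤1+n c
  ... | false = ≤-refl

  greedyStep-≤ : ∀ c l → greedyStep c l ≤ suc c
  greedyStep-≤ c l with c <ᵇ l
  ... | true = ≤-refl
  ... | false = n≤1+n c

  greedyStep-< : ∀ {c l} → c < l → greedyStep c l ≡ suc c
  greedyStep-< {c} {l} lt = cong (λ b → if b then suc c else c) (<⇒<ᵇ≡true lt)

  greedyStep-monoˡ : ∀ {c c′} l → c ≤ c′ → greedyStep c l ≤ greedyStep c′ l
  greedyStep-monoˡ {c} {c′} l le with c <ᵇ l in e1 | c′ <ᵇ l in e2
  ... | true | true = s≤s le
  ... | true | false = ≤-trans (<ᵇ≡true⇒< {c} {l} e1) (<ᵇ≡false⇒≥ {c′} {l} e2)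
  ... | false | true = ≤-trans le (n≤1+n c′)
  ... | false | false = le

  greedyStep-monoʳ : ∀ c {l l′} → l ≤ l′ → greedyStep c l ≤ greedyStep c l′
  greedyStep-monoʳ c {l} {l′} le with c <ᵇ l in e1 | c <ᵇ l′ in e2
  ... | true | true = ≤-refl
  ... | true | false = ⊥-elim (<⇒≱ (≤-trans (<ᵇ≡true⇒< {c} {l} e1) le) (<ᵇ≡false⇒≥ {c} {l′} e2))
  ... | false | true = n≤1+n c
  ... | false | false = ≤-refl

  greedy-≥ : ∀ c σ → c ≤ greedy c σ
  greedy-≥ c [] = ≤-refl
  greedy-≥ c (l ∷ σ) = ≤-trans (greedyStep-≥ c l) (greedy-≥ (greedyStep c l) σ)

  greedy-≤ : ∀ c σ → greedy c σ ≤ c + length σ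
  greedy-≤ c [] = ≤-reflexive (sym (+-identityʳ c))
  greedy-≤ c (l ∷ σ) = ≤-trans (greedy-≤ (greedyStep c l) σ)
    (≤-trans (+-monoˡ-≤ (length σ) (greedyStep-≤ c l)) (≤-reflexive (sym (+-suc c (length σ)))))

  greedy-monoˡ : ∀ {c c′} σ → c ≤ c′ → greedy c σ ≤ greedy c′ σ
  greedy-monoˡ [] le = le
  greedy-monoˡ (l ∷ σ) le = greedy-monoˡ σ (greedyStep-monoˡ l le)

  greedy-mono : ∀ {c c′} {σ σ′} → c ≤ c′ → Pointwise _≤_ σ σ′ → greedy c σ ≤ greedy c′ σ′
  greedy-mono le [] = le
  greedy-mono {c} {c′} le (_∷_ {x = l} l≤l′ σ≤σ′) =
    greedy-mono (≤-trans (greedyStep-monoˡ l le) (greedyStep-monoʳ c′ l≤l′)) σ≤σ′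

  greedy-∷-≥ : ∀ l c σ → greedy c σ ≤ greedy c (l ∷ σ)
  greedy-∷-≥ l c σ = greedy-monoˡ σ (greedyStep-≥ c l)

  sumInserts-greedy-≥ : ∀ x c σ → suc (length σ) * greedy c σ ≤ sumInserts x (greedy c) σ
  sumInserts-greedy-≥ x c [] = ≤-trans (≤-reflexive (+-identityʳ c)) (greedyStep-≥ c x)
  sumInserts-greedy-≥ x c (y ∷ σ) = +-mono-≤ (greedy-∷-≥ x c (y ∷ σ)) (sumInserts-greedy-≥ x (greedyStep c y) σ)

  sumPerms-greedy-∷-≥ : ∀ c x R → suc (length R) * sumPerms (greedy c) R ≤ sumPerms (greedy c) (x ∷ R)
  sumPerms-greedy-∷-≥ c x R = ≤-trans (≤-reflexive (sym (sumPerms-* (suc (length R)) (greedy c) R)))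
    (sumPerms-mono-All U _ _ R (universal-U R) (λ σ e _ → subst (λ z → suc z * greedy c σ ≤ sumInserts x (greedy c) σ) e (sumInserts-greedy-≥ x c σ)))

  sumPerms-greedy-++-≥ : ∀ c X R → sumPerms (greedy c) R * length (X ++ R) ! ≤ sumPerms (greedy c) (X ++ R) * length R !
  sumPerms-greedy-++-≥ c [] R = ≤-refl
  sumPerms-greedy-++-≥ c (x ∷ X) R = begin
      PR * (suc L * L !)
    ≡⟨ x∙yz≈y∙xz PR (suc L) (L !) ⟩
      suc L * (PR * L !)
    ≤⟨ *-monoʳ-≤ (suc L) (sumPerms-greedy-++-≥ c X R) ⟩
      suc L * (sumPerms (greedy c) Y * length R !)
    ≡⟨ sym (*-assoc (suc L) (sumPerms (greedy c) Y) (length R !)) ⟩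
      suc L * sumPerms (greedy c) Y * length R !
    ≤⟨ *-monoˡ-≤ (length R !) (sumPerms-greedy-∷-≥ c x Y) ⟩
      sumPerms (greedy c) (x ∷ Y) * length R !
    ∎
    where
    open ≤-Reasoning
    Y = X ++ R
    L = length Y
    PR = sumPerms (greedy c) R

  sumInserts-dead : ∀ d c σ → d ≤ c → sumInserts d (greedy c) σ ≡ suc (length σ) * greedy c σ
  sumInserts-dead d c [] le rewrite ≥⇒<ᵇ≡false le = sym (+-identityʳ c)
  sumInserts-dead d c (y ∷ σ) le rewrite ≥⇒<ᵇ≡false le =
    cong (greedy (greedyStep c y) σ +_) (sumInserts-dead d (greedyStep c y) σ (≤-trans le (greedyStep-≥ c y)))

  sumPerms-dead-head : ∀ d c R → d ≤ c → sumPerms (greedy c) (d ∷ R) ≡ suc (length R) * sumPerms (greedy c) R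
  sumPerms-dead-head d c R le = trans (sumPerms-cong-length (sumInserts d (greedy c)) (λ σ → suc (length R) * greedy c σ) R
    (λ σ e → trans (sumInserts-dead d c σ le) (cong (λ w → suc w * greedy c σ) e))) (sumPerms-* (suc (length R)) (greedy c) R)

  greedy-allDead : ∀ c σ → All (λ x → x ≤ c) σ → greedy c σ ≡ c
  greedy-allDead c [] _ = refl
  greedy-allDead c (y ∷ σ) (py ∷ pσ) rewrite ≥⇒<ᵇ≡false py = greedy-allDead c σ pσ

  sumPerms-allDead : ∀ c R → All (λ x → x ≤ c) R → sumPerms (greedy c) R ≡ length R ! * c
  sumPerms-allDead c R pR = trans (sumPerms-cong-All (λ x → x ≤ c) (greedy c) (λ _ → c) R pR (λ σ _ pσ → greedy-allDead c σ pσ)) (sumPerms-const c R)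


module Staircase where

  open import Data.Nat
  open import Data.Nat.Properties
  open import Data.List using (List; []; _∷_; length; _++_; map; take)
  open import Data.List.Properties using (map-++; take-map; length-take)
  open import Data.List.Relation.Unary.All using (All; []; _∷_)
  open import Data.List.Relation.Unary.All.Properties using (++⁺; take⁺)
  open import Relation.Binary.PropositionalEquality
  open import Relation.Nullary using (¬_; yes; no)
  open import Data.Bool using (true; false; if_then_else_)
  open import Algebra.Properties.CommutativeSemigroup +-commutativeSemigroup using (x∙yz≈y∙xz)
  open RangeSums
  open PermutationSums
  open Greedy

  nth : ℕ → List ℕ → ℕ
  nth _ [] = 0
  nth zero (x ∷ _) = x
  nth (suc t) (_ ∷ σ) = nth t σ

  -- Positions past the end of σ count as skipped, since nth returns 0 there.
  skipped : ℕ → ℕ → List ℕ → ℕ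
  skipped c t σ = if greedy c (take t σ) <ᵇ nth t σ then 0 else 1

  skipped+greedyStep : ∀ c l → (if c <ᵇ l then 0 else 1) + greedyStep c l ≡ suc c
  skipped+greedyStep c l with c <ᵇ l
  ... | true = refl
  ... | false = refl

  greedy+skipped : ∀ s c σ → greedy c (take s σ) + sumTo s (λ t → skipped c t σ) ≡ c + s
  greedy+skipped zero c σ = refl
  greedy+skipped (suc s) c [] = cong (c +_) (cong suc (sumTo-one s))
  greedy+skipped (suc s) c (l ∷ σ) = begin
      greedy (greedyStep c l) (take s σ) + (b + S)
    ≡⟨ x∙yz≈y∙xz (greedy (greedyStep c l) (take s σ)) b S ⟩
      b + (greedy (greedyStep c l) (take s σ) + S)
    ≡⟨ cong (b +_) (greedy+skipped s (greedyStep c l) σ) ⟩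
      b + (greedyStep c l + s)
    ≡⟨ sym (+-assoc b (greedyStep c l) s) ⟩
      b + greedyStep c l + s
    ≡⟨ cong (_+ s) (skipped+greedyStep c l) ⟩
      suc c + s
    ≡⟨ sym (+-suc c s) ⟩
      c + suc s
    ∎
    where
    open ≡-Reasoning
    b = if c <ᵇ l then 0 else 1
    S = sumTo s (λ t → skipped (greedyStep c l) t σ)

  take-insertAt : ∀ t (v : ℕ) π → t ≤ length π → take t (insertAt t v π) ≡ take t π
  take-insertAt zero v π le = refl
  take-insertAt (suc t) v (x ∷ π) (s≤s le) = cong (x ∷_) (take-insertAt t v π le)

  nth-insertAt : ∀ t v π → t ≤ length π → nth t (insertAt t v π) ≡ v
  nth-insertAt zero v π le = refl
  nth-insertAt (suc t) v (x ∷ π) (s≤s le) = nth-insertAt t v π le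

  upFrom : ℕ → ℕ → List ℕ
  upFrom a zero = []
  upFrom a (suc n) = a ∷ upFrom (suc a) n

  length-upFrom : ∀ a n → length (upFrom a n) ≡ n
  length-upFrom a zero = refl
  length-upFrom a (suc n) = cong suc (length-upFrom (suc a) n)

  staircase : ℕ → List ℕ
  staircase k = upFrom 1 k

  sumPicks-upFrom : ∀ (f : ℕ → List ℕ → ℕ) a n →
    sumPicks f (upFrom a n) ≡ sumTo n (λ i → f (i + a) (upFrom a i ++ upFrom (suc (i + a)) (n ∸ suc i)))
  sumPicks-upFrom f a zero = refl
  sumPicks-upFrom f a (suc n) = cong (f a (upFrom (suc a) n) +_)
    (trans (sumPicks-upFrom (λ y ys → f y (a ∷ ys)) (suc a) n)
      (sumTo-cong n _ _ (λ i → cong (λ w → f w (a ∷ (upFrom (suc a) i ++ upFrom (suc w) (n ∸ suc i)))) (+-suc i a))))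

  upFrom-++ : ∀ a i j → upFrom a i ++ upFrom (i + a) j ≡ upFrom a (i + j)
  upFrom-++ a zero j = refl
  upFrom-++ a (suc i) j = cong (a ∷_) (trans (cong (λ w → upFrom (suc a) i ++ upFrom w j) (sym (+-suc i a))) (upFrom-++ (suc a) i j))

  -- Renumbering the staircase with the value v removed: the values above v move down by one.
  closeGap : ℕ → ℕ → ℕ
  closeGap v l = if l <ᵇ v then l else pred l

  map-closeGap-below : ∀ v a i → i + a ≤ v → map (closeGap v) (upFrom a i) ≡ upFrom a i
  map-closeGap-below v a zero le = refl
  map-closeGap-below v a (suc i) le rewrite <⇒<ᵇ≡true {a} {v} (≤-trans (s≤s (m≤n+m a i)) le) =
    cong (a ∷_) (map-closeGap-below v (suc a) i (≤-trans (≤-reflexive (+-suc i a)) le))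

  map-closeGap-above : ∀ v j a → v < a → map (closeGap v) (upFrom a j) ≡ upFrom (pred a) j
  map-closeGap-above v zero a lt = refl
  map-closeGap-above v (suc j) (suc a) lt rewrite ≥⇒<ᵇ≡false {suc a} {v} (<⇒≤ lt) =
    cong (a ∷_) (map-closeGap-above v j (suc (suc a)) (≤-trans lt (n≤1+n _)))

  closeGap-staircase : ∀ i m → i ≤ m → map (closeGap (i + 1)) (upFrom 1 i ++ upFrom (suc (i + 1)) (m ∸ i)) ≡ upFrom 1 m
  closeGap-staircase i m le = begin
      map (closeGap (i + 1)) (upFrom 1 i ++ upFrom (suc (i + 1)) (m ∸ i))
    ≡⟨ map-++ (closeGap (i + 1)) (upFrom 1 i) _ ⟩
      map (closeGap (i + 1)) (upFrom 1 i) ++ map (closeGap (i + 1)) (upFrom (suc (i + 1)) (m ∸ i))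
    ≡⟨ cong₂ _++_ (map-closeGap-below (i + 1) 1 i ≤-refl) (map-closeGap-above (i + 1) (m ∸ i) (suc (i + 1)) ≤-refl) ⟩
      upFrom 1 i ++ upFrom (i + 1) (m ∸ i)
    ≡⟨ upFrom-++ 1 i (m ∸ i) ⟩
      upFrom 1 (i + (m ∸ i))
    ≡⟨ cong (upFrom 1) (m+[n∸m]≡n le) ⟩
      upFrom 1 m
    ∎
    where open ≡-Reasoning

  greedyStep-closeGap : ∀ v c l → c < v → ¬ (l ≡ v) → greedyStep c l ≡ greedyStep c (closeGap v l)
  greedyStep-closeGap v c l cv lv with l <ᵇ v in e
  ... | true = refl
  ... | false = trans (greedyStep-< {c} {l} (<-≤-trans cv (<ᵇ≡false⇒≥ {l} {v} e)))
    (sym (greedyStep-< {c} {pred l} (<-≤-trans cv vpl)))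
    where
    vpl : v ≤ pred l
    vpl = pred-mono-≤ (≤∧≢⇒< (<ᵇ≡false⇒≥ {l} {v} e) (λ q → lv (sym q)))

  greedy-closeGap : ∀ v c π → c < v → All (λ x → ¬ (x ≡ v)) π → (greedy c π <ᵇ v) ≡ (greedy c (map (closeGap v) π) <ᵇ v)
  greedy-closeGap v c [] cv pa = refl
  greedy-closeGap v c (l ∷ π) cv (pl ∷ pa) rewrite greedyStep-closeGap v c l cv pl with greedyStep c (closeGap v l) <? v
  ... | yes lt = greedy-closeGap v (greedyStep c (closeGap v l)) π lt pa
  ... | no nlt = trans (≥⇒<ᵇ≡false (≤-trans (≮⇒≥ nlt) (greedy-≥ _ π))) (sym (≥⇒<ᵇ≡false (≤-trans (≮⇒≥ nlt) (greedy-≥ _ (map (closeGap v) π)))))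

  count-below : ∀ n x → x ≤ n → sumTo n (λ i → if x <ᵇ suc i then 0 else 1) ≡ x
  count-below n zero le = sumTo-zero n
  count-below (suc n) (suc x) (s≤s le) = cong suc (count-below n x le)

  upFrom-≢-above : ∀ a n v → n + a ≤ v → All (λ x → ¬ (x ≡ v)) (upFrom a n)
  upFrom-≢-above a zero v le = []
  upFrom-≢-above a (suc n) v le = (λ q → <⇒≢ (≤-trans (s≤s (m≤n+m a n)) le) q) ∷ upFrom-≢-above (suc a) n v (≤-trans (≤-reflexive (+-suc n a)) le)

  upFrom-≢-below : ∀ a n v → v < a → All (λ x → ¬ (x ≡ v)) (upFrom a n)
  upFrom-≢-below a zero v lt = []
  upFrom-≢-below a (suc n) v lt = (λ q → <⇒≢ lt (sym q)) ∷ upFrom-≢-below (suc a) n v (≤-trans lt (n≤1+n a))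

  reached : ℕ → ℕ → List ℕ → ℕ
  reached t v π = if greedy 0 (take t π) <ᵇ v then 0 else 1

  greedy-take-≤ : ∀ t τ → greedy 0 (take t τ) ≤ t
  greedy-take-≤ t τ = ≤-trans (greedy-≤ 0 (take t τ)) (≤-trans (≤-reflexive (length-take t τ)) (m⊓n≤m t (length τ)))

  sumPerms-reached-closeGap : ∀ t m i → i ≤ m →
    sumPerms (reached t (i + 1)) (upFrom 1 i ++ upFrom (suc (i + 1)) (m ∸ i)) ≡ sumPerms (reached t (i + 1)) (staircase m)
  sumPerms-reached-closeGap t m i le = begin
      sumPerms (reached t v) Q
    ≡⟨ sumPerms-cong-All (λ x → ¬ (x ≡ v)) (reached t v) (λ σ → reached t v (map (closeGap v) σ)) Q allQ
         (λ τ _ pτ → trans (relabel τ pτ) (cong (λ w → if greedy 0 w <ᵇ v then 0 else 1) (sym (take-map t τ)))) ⟩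
      sumPerms (λ σ → reached t v (map (closeGap v) σ)) Q
    ≡⟨ sym (sumPerms-map (closeGap v) (reached t v) Q) ⟩
      sumPerms (reached t v) (map (closeGap v) Q)
    ≡⟨ cong (sumPerms (reached t v)) (closeGap-staircase i m le) ⟩
      sumPerms (reached t v) (staircase m)
    ∎
    where
    open ≡-Reasoning
    v = i + 1
    Q = upFrom 1 i ++ upFrom (suc (i + 1)) (m ∸ i)
    allQ : All (λ x → ¬ (x ≡ v)) Q
    allQ = ++⁺ (upFrom-≢-above 1 i v ≤-refl) (upFrom-≢-below (suc v) (m ∸ i) v ≤-refl)
    v>0 : 0 < v
    v>0 = subst (0 <_) (+-comm 1 i) z<s
    relabel : ∀ τ → All (λ x → ¬ (x ≡ v)) τ → reached t v τ ≡ (if greedy 0 (map (closeGap v) (take t τ)) <ᵇ v then 0 else 1)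
    relabel τ pτ = cong (λ b → if b then 0 else 1) (greedy-closeGap v 0 (take t τ) v>0 (take⁺ t pτ))

  -- The entry at position t is skipped iff its value v is at most the count after the first t entries.
  -- Fixing v and closing the gap it leaves turns the other entries into an ordering of a smaller staircase
  -- on which that count reaches v just as before, and summing this indicator over v gives back the count.
  sumPerms-skipped-staircase : ∀ m t → t ≤ m → sumPerms (skipped 0 t) (staircase (suc m)) ≡ sumPerms (λ τ → greedy 0 (take t τ)) (staircase m)
  sumPerms-skipped-staircase m t le = begin
      sumPerms (skipped 0 t) (staircase (suc m))
    ≡⟨ sumPerms-byPosition t (skipped 0 t) (staircase (suc m)) (subst (t <_) (sym (length-upFrom 1 (suc m))) (s≤s le)) ⟩
      sumPicks (λ v Q → sumPerms (λ π → skipped 0 t (insertAt t v π)) Q) (staircase (suc m))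
    ≡⟨ sumPicks-cong-length _ _ m fixAt (staircase (suc m)) (length-upFrom 1 (suc m)) ⟩
      sumPicks (λ v Q → sumPerms (reached t v) Q) (staircase (suc m))
    ≡⟨ sumPicks-upFrom (λ v Q → sumPerms (reached t v) Q) 1 (suc m) ⟩
      sumTo (suc m) (λ i → sumPerms (reached t (i + 1)) (upFrom 1 i ++ upFrom (suc (i + 1)) (m ∸ i)))
    ≡⟨ sumTo-cong-< (suc m) _ _ (λ i lt → sumPerms-reached-closeGap t m i (≤-pred lt)) ⟩
      sumTo (suc m) (λ i → sumPerms (reached t (i + 1)) (staircase m))
    ≡⟨ sym (sumPerms-sumTo (suc m) (λ i → reached t (i + 1)) (staircase m)) ⟩
      sumPerms (λ τ → sumTo (suc m) (λ i → reached t (i + 1) τ)) (staircase m)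
    ≡⟨ sumPerms-cong-length _ _ (staircase m) (λ τ _ → countReached τ) ⟩
      sumPerms (λ τ → greedy 0 (take t τ)) (staircase m)
    ∎
    where
    open ≡-Reasoning
    fixAt : ∀ v Q → length Q ≡ m → sumPerms (λ π → skipped 0 t (insertAt t v π)) Q ≡ sumPerms (reached t v) Q
    fixAt v Q e = sumPerms-cong-length _ _ Q (λ τ e′ → cong₂ (λ a b → if greedy 0 a <ᵇ b then 0 else 1)
      (take-insertAt t v τ (subst (t ≤_) (sym (trans e′ e)) le)) (nth-insertAt t v τ (subst (t ≤_) (sym (trans e′ e)) le)))
    countReached : ∀ τ → sumTo (suc m) (λ i → reached t (i + 1) τ) ≡ greedy 0 (take t τ)
    countReached τ = trans (sumTo-cong (suc m) _ _ (λ i → cong (λ w → if greedy 0 (take t τ) <ᵇ w then 0 else 1) (+-comm i 1)))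
                 (count-below (suc m) (greedy 0 (take t τ)) (≤-trans (greedy-take-≤ t τ) (≤-trans le (n≤1+n m))))

  staircaseGain : ℕ → ℕ → ℕ
  staircaseGain k s = sumPerms (λ σ → greedy 0 (take s σ)) (staircase k)

  staircaseGain-rec : ∀ m s → s ≤ suc m → staircaseGain (suc m) s + sumTo s (λ t → staircaseGain m t) ≡ suc m ! * s
  staircaseGain-rec m s le = begin
      staircaseGain (suc m) s + sumTo s (λ t → staircaseGain m t)
    ≡⟨ cong (staircaseGain (suc m) s +_) (sym (sumTo-cong-< s _ _ (λ t lt → sumPerms-skipped-staircase m t (≤-pred (≤-trans lt le))))) ⟩
      staircaseGain (suc m) s + sumTo s (λ t → sumPerms (skipped 0 t) (staircase (suc m)))
    ≡⟨ cong (staircaseGain (suc m) s +_) (sym (sumPerms-sumTo s (λ t σ → skipped 0 t σ) (staircase (suc m)))) ⟩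
      staircaseGain (suc m) s + sumPerms (λ σ → sumTo s (λ t → skipped 0 t σ)) (staircase (suc m))
    ≡⟨ sym (sumPerms-+ (λ σ → greedy 0 (take s σ)) (λ σ → sumTo s (λ t → skipped 0 t σ)) (staircase (suc m))) ⟩
      sumPerms (λ σ → greedy 0 (take s σ) + sumTo s (λ t → skipped 0 t σ)) (staircase (suc m))
    ≡⟨ sumPerms-cong _ _ (λ σ → greedy+skipped s 0 σ) (staircase (suc m)) ⟩
      sumPerms (λ σ → s) (staircase (suc m))
    ≡⟨ sumPerms-const s (staircase (suc m)) ⟩
      length (staircase (suc m)) ! * s
    ≡⟨ cong (λ w → w ! * s) (length-upFrom 1 (suc m)) ⟩
      suc m ! * s
    ∎
    where open ≡-Reasoning


  staircaseGain-step : ∀ m s → suc s ≤ suc m →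
    staircaseGain (suc m) (suc s) + staircaseGain m s ≡ staircaseGain (suc m) s + suc m !
  staircaseGain-step m s le = +-cancelʳ-≡ Σs _ _ (begin
      X′ + g + Σs
    ≡⟨ trans (+-assoc X′ g Σs) (cong (X′ +_) (trans (+-comm g Σs) (sym (sumTo-last s (staircaseGain m))))) ⟩
      X′ + sumTo (suc s) (staircaseGain m)
    ≡⟨ staircaseGain-rec m (suc s) le ⟩
      K * suc s
    ≡⟨ trans (*-suc K s) (+-comm K (K * s)) ⟩
      K * s + K
    ≡⟨ cong (_+ K) (sym (staircaseGain-rec m s (≤-trans (n≤1+n s) le))) ⟩
      X + Σs + K
    ≡⟨ trans (+-assoc X Σs K) (trans (cong (X +_) (+-comm Σs K)) (sym (+-assoc X K Σs))) ⟩
      X + K + Σs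
    ∎)
    where
    open ≡-Reasoning
    K = suc m !
    X′ = staircaseGain (suc m) (suc s)
    X = staircaseGain (suc m) s
    g = staircaseGain m s
    Σs = sumTo s (staircaseGain m)


module Rationals where

  open import Data.Nat as ℕ using (ℕ; suc)
  import Data.Nat.Properties as ℕP
  open import Data.Integer as ℤ using (+_)
  import Data.Integer.Properties as ℤP
  open import Data.Rational using (0ℚ; 1ℚ; _+_; _*_; _≤_; _/_; toℚᵘ)
  open import Data.Rational using () renaming (nonNegative to mkNN)
  import Data.Rational.Properties as ℚP
  import Data.Rational.Unnormalised as U
  import Data.Rational.Unnormalised.Properties as UP
  open import Relation.Binary.PropositionalEquality
  open import Defs using (ℕtoℚ)

  -- mkℚᵘ stores the denominator minus one, so this is m / 1.
  ℕtoℚᵘ : ℕ → U.ℚᵘ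
  ℕtoℚᵘ m = U.mkℚᵘ (+ m) 0

  toℚᵘ-ℕtoℚ : ∀ m → toℚᵘ (ℕtoℚ m) U.≃ ℕtoℚᵘ m
  toℚᵘ-ℕtoℚ m = ℚP.toℚᵘ-fromℚᵘ (ℕtoℚᵘ m)

  ℕtoℚᵘ-+ : ∀ a b → ℕtoℚᵘ a U.+ ℕtoℚᵘ b U.≃ ℕtoℚᵘ (a ℕ.+ b)
  ℕtoℚᵘ-+ a b = U.*≡* (begin
      (+ a ℤ.* + 1 ℤ.+ + b ℤ.* + 1) ℤ.* + 1
    ≡⟨ ℤP.*-identityʳ _ ⟩
      + a ℤ.* + 1 ℤ.+ + b ℤ.* + 1
    ≡⟨ cong₂ ℤ._+_ (ℤP.*-identityʳ (+ a)) (ℤP.*-identityʳ (+ b)) ⟩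
      + a ℤ.+ + b
    ≡⟨ sym (ℤP.pos-+ a b) ⟩
      + (a ℕ.+ b)
    ≡⟨ sym (ℤP.*-identityʳ _) ⟩
      + (a ℕ.+ b) ℤ.* + 1
    ∎)
    where open ≡-Reasoning

  ℕtoℚᵘ-* : ∀ a b → ℕtoℚᵘ a U.* ℕtoℚᵘ b U.≃ ℕtoℚᵘ (a ℕ.* b)
  ℕtoℚᵘ-* a b = U.*≡* (cong (ℤ._* + 1) (sym (ℤP.pos-* a b)))

  ℕtoℚ-+ : ∀ a b → ℕtoℚ (a ℕ.+ b) ≡ ℕtoℚ a + ℕtoℚ b
  ℕtoℚ-+ a b = ℚP.toℚᵘ-injective (UP.≃-trans (toℚᵘ-ℕtoℚ (a ℕ.+ b)) (UP.≃-sym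
    (UP.≃-trans (ℚP.toℚᵘ-homo-+ (ℕtoℚ a) (ℕtoℚ b)) (UP.≃-trans (UP.+-cong (toℚᵘ-ℕtoℚ a) (toℚᵘ-ℕtoℚ b)) (ℕtoℚᵘ-+ a b)))))

  ℕtoℚ-* : ∀ a b → ℕtoℚ (a ℕ.* b) ≡ ℕtoℚ a * ℕtoℚ b
  ℕtoℚ-* a b = ℚP.toℚᵘ-injective (UP.≃-trans (toℚᵘ-ℕtoℚ (a ℕ.* b)) (UP.≃-sym
    (UP.≃-trans (ℚP.toℚᵘ-homo-* (ℕtoℚ a) (ℕtoℚ b)) (UP.≃-trans (UP.*-cong (toℚᵘ-ℕtoℚ a) (toℚᵘ-ℕtoℚ b)) (ℕtoℚᵘ-* a b)))))

  [1/n]*n≡1 : ∀ n .{{_ : ℕ.NonZero n}} → (+ 1 / n) * ℕtoℚ n ≡ 1ℚ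
  [1/n]*n≡1 (suc k) = ℚP.toℚᵘ-injective (UP.≃-trans (ℚP.toℚᵘ-homo-* (+ 1 / suc k) (ℕtoℚ (suc k)))
    (UP.≃-trans (UP.*-cong (ℚP.toℚᵘ-fromℚᵘ (U.mkℚᵘ (+ 1) k)) (toℚᵘ-ℕtoℚ (suc k)))
      (U.*≡* (trans (ℤP.*-identityʳ _) (cong (λ w → + 1 ℤ.* + w) (sym (ℕP.*-identityʳ (suc k))))))))

  ℕtoℚ-mono-≤ : ∀ {a b} → a ℕ.≤ b → ℕtoℚ a ≤ ℕtoℚ b
  ℕtoℚ-mono-≤ {a} {b} le = ℚP.toℚᵘ-cancel-≤ (UP.≤-respʳ-≃ (UP.≃-sym (toℚᵘ-ℕtoℚ b)) (UP.≤-respˡ-≃ (UP.≃-sym (toℚᵘ-ℕtoℚ a))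
    (U.*≤* (ℤP.*-monoʳ-≤-nonNeg (+ 1) (ℤ.+≤+ le)))))

  *-monoˡ-≤-0≤ : ∀ {r p q} → 0ℚ ≤ r → p ≤ q → r * p ≤ r * q
  *-monoˡ-≤-0≤ {r} h le = ℚP.*-monoˡ-≤-nonNeg r {{mkNN h}} le

  *-monoʳ-≤-0≤ : ∀ {r p q} → 0ℚ ≤ r → p ≤ q → p * r ≤ q * r
  *-monoʳ-≤-0≤ {r} h le = ℚP.*-monoʳ-≤-nonNeg r {{mkNN h}} le

  0≤ℕtoℚ : ∀ n → 0ℚ ≤ ℕtoℚ n
  0≤ℕtoℚ n = ℕtoℚ-mono-≤ {0} {n} ℕ.z≤n

  0≤-* : ∀ {x y} → 0ℚ ≤ x → 0ℚ ≤ y → 0ℚ ≤ x * y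
  0≤-* {x} {y} hx hy = subst (_≤ x * y) (ℚP.*-zeroʳ x) (*-monoˡ-≤-0≤ hx hy)


module RationalSums where

  open import Data.Nat using (ℕ; zero; suc; _<_; z<s; s<s)
  open import Data.Rational using (ℚ; 0ℚ; _+_; _*_; -_; _≤_)
  import Data.Rational.Properties as ℚP
  open import Data.Rational.Solver
  open +-*-Solver
  open import Relation.Binary.PropositionalEquality

  sumToℚ : ℕ → (ℕ → ℚ) → ℚ
  sumToℚ zero f = 0ℚ
  sumToℚ (suc n) f = f 0 + sumToℚ n (λ i → f (suc i))

  sumToℚ-cong : ∀ n (f g : ℕ → ℚ) → (∀ i → f i ≡ g i) → sumToℚ n f ≡ sumToℚ n g
  sumToℚ-cong zero f g e = refl
  sumToℚ-cong (suc n) f g e = cong₂ _+_ (e 0) (sumToℚ-cong n _ _ (λ i → e (suc i)))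

  sumToℚ-last : ∀ n (f : ℕ → ℚ) → sumToℚ (suc n) f ≡ sumToℚ n f + f n
  sumToℚ-last zero f = trans (ℚP.+-identityʳ (f 0)) (sym (ℚP.+-identityˡ (f 0)))
  sumToℚ-last (suc n) f = trans (cong (f 0 +_) (sumToℚ-last n (λ i → f (suc i)))) (sym (ℚP.+-assoc (f 0) _ _))

  sumToℚ-+ : ∀ n (f g : ℕ → ℚ) → sumToℚ n (λ i → f i + g i) ≡ sumToℚ n f + sumToℚ n g
  sumToℚ-+ zero f g = refl
  sumToℚ-+ (suc n) f g = trans (cong ((f 0 + g 0) +_) (sumToℚ-+ n _ _))
    (solve 4 (λ a b c d → (a :+ b) :+ (c :+ d) := (a :+ c) :+ (b :+ d)) refl (f 0) (g 0) _ _)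

  sumToℚ-* : ∀ n (a : ℚ) (f : ℕ → ℚ) → sumToℚ n (λ i → a * f i) ≡ a * sumToℚ n f
  sumToℚ-* zero a f = sym (ℚP.*-zeroʳ a)
  sumToℚ-* (suc n) a f = trans (cong (a * f 0 +_) (sumToℚ-* n a _)) (sym (ℚP.*-distribˡ-+ a (f 0) _))

  sumToℚ-neg : ∀ n (f : ℕ → ℚ) → sumToℚ n (λ i → - f i) ≡ - sumToℚ n f
  sumToℚ-neg zero f = refl
  sumToℚ-neg (suc n) f = trans (cong (- f 0 +_) (sumToℚ-neg n _)) (sym (ℚP.neg-distrib-+ (f 0) _))

  sumToℚ-zero : ∀ n → sumToℚ n (λ _ → 0ℚ) ≡ 0ℚ
  sumToℚ-zero zero = refl
  sumToℚ-zero (suc n) = trans (ℚP.+-identityˡ _) (sumToℚ-zero n)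

  sumToℚ-*-sumToℚ : ∀ n m (f g : ℕ → ℚ) → sumToℚ n f * sumToℚ m g ≡ sumToℚ n (λ i → sumToℚ m (λ j → f i * g j))
  sumToℚ-*-sumToℚ zero m f g = ℚP.*-zeroˡ (sumToℚ m g)
  sumToℚ-*-sumToℚ (suc n) m f g = trans (ℚP.*-distribʳ-+ (sumToℚ m g) (f 0) _)
    (cong₂ _+_ (sym (sumToℚ-* m (f 0) g)) (sumToℚ-*-sumToℚ n m _ g))

  sumToℚ-mono : ∀ n (f g : ℕ → ℚ) → (∀ i → f i ≤ g i) → sumToℚ n f ≤ sumToℚ n g
  sumToℚ-mono zero f g h = ℚP.≤-refl
  sumToℚ-mono (suc n) f g h = ℚP.+-mono-≤ (h 0) (sumToℚ-mono n _ _ (λ i → h (suc i)))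

  sumToℚ-cong-< : ∀ n (f g : ℕ → ℚ) → (∀ i → i < n → f i ≡ g i) → sumToℚ n f ≡ sumToℚ n g
  sumToℚ-cong-< zero f g e = refl
  sumToℚ-cong-< (suc n) f g e = cong₂ _+_ (e 0 z<s) (sumToℚ-cong-< n _ _ (λ i lt → e (suc i) (s<s lt)))


module ItemLists where

  open import Data.Nat
  open import Data.Nat.Properties
  open import Data.Fin using (Fin) renaming (_≟_ to _≟ᶠ_)
  open import Data.List using (List; []; _∷_; length; _++_; map; filterᵇ)
  open import Data.Nat.ListAction using (sum)
  open import Data.List.Properties using (filter-all)
  open import Data.List.Relation.Unary.All as All using (All; []; _∷_)
  open import Data.List.Relation.Unary.Any using (here; there)
  open import Data.List.Membership.Propositional using (_∈_)
  open import Data.List.Membership.Propositional.Properties using (∈-filter⁺)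
  open import Data.List.Relation.Unary.Unique.Propositional using (Unique)
  import Data.List.Relation.Unary.Unique.Propositional.Properties as Unique
  open import Data.List.Relation.Unary.AllPairs using ([]; _∷_)
  import Data.List.Relation.Binary.Permutation.Propositional as Perm
  import Data.List.Relation.Binary.Permutation.Propositional.Properties as PermP
  open Perm using (_↭_)
  open import Relation.Binary.PropositionalEquality
  open import Relation.Nullary using (¬_; yes; no; ¬?)
  open import Data.Bool using (Bool; true; false; not)
  open import Data.Empty using (⊥-elim)
  open import Data.Product using (Σ; _,_)
  open import Algebra.Properties.CommutativeSemigroup +-commutativeSemigroup using (x∙yz≈y∙xz)
  open import Defs using (removeItem)
  open PermutationSums

  module _ {A : Set} where

    sum-map-cong-All : ∀ (f g : A → ℕ) (L : List A) → All (λ i → f i ≡ g i) L → sum (map f L) ≡ sum (map g L)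
    sum-map-cong-All f g [] _ = refl
    sum-map-cong-All f g (x ∷ L) (p ∷ ps) = cong₂ _+_ p (sum-map-cong-All f g L ps)

    sum-filter-split : ∀ (b : A → Bool) (k : A → ℕ) S →
      sum (map k S) ≡ sum (map k (filterᵇ b S)) + sum (map k (filterᵇ (λ i → not (b i)) S))
    sum-filter-split b k [] = refl
    sum-filter-split b k (x ∷ S) with b x
    ... | true = trans (cong (k x +_) (sum-filter-split b k S)) (sym (+-assoc (k x) _ _))
    ... | false = trans (cong (k x +_) (sum-filter-split b k S)) (x∙yz≈y∙xz (k x) (sum (map k (filterᵇ b S))) (sum (map k (filterᵇ (λ i → not (b i)) S))))

    length-filter-split : ∀ (b : A → Bool) S → length S ≡ length (filterᵇ b S) + length (filterᵇ (λ i → not (b i)) S)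
    length-filter-split b [] = refl
    length-filter-split b (x ∷ S) with b x
    ... | true = cong suc (length-filter-split b S)
    ... | false = trans (cong suc (length-filter-split b S)) (sym (+-suc _ _))

    filter-true : ∀ (b : A → Bool) S → All (λ i → b i ≡ true) (filterᵇ b S)
    filter-true b [] = []
    filter-true b (x ∷ S) with b x in e
    ... | true = e ∷ filter-true b S
    ... | false = filter-true b S

    filter-false : ∀ (b : A → Bool) S → All (λ i → b i ≡ false) (filterᵇ (λ i → not (b i)) S)
    filter-false b [] = []
    filter-false b (x ∷ S) with b x in e
    ... | true = filter-false b S
    ... | false = e ∷ filter-false b S

    filter-All : ∀ {P : A → Set} (b : A → Bool) S → All P S → All P (filterᵇ b S)
    filter-All b [] _ = []
    filter-All b (x ∷ S) (px ∷ pS) with b x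
    ... | true = px ∷ filter-All b S pS
    ... | false = filter-All b S pS

    filter-[] : ∀ (b : A → Bool) S → filterᵇ b S ≡ [] → All (λ i → b i ≡ false) S
    filter-[] b [] _ = []
    filter-[] b (x ∷ S) e with b x in ex
    filter-[] b (x ∷ S) () | true
    ... | false = ex ∷ filter-[] b S e

    sum-map-const-All : ∀ m (k : A → ℕ) X (L : List A) → All (λ i → m * k i ≡ X) L → m * sum (map k L) ≡ length L * X
    sum-map-const-All m k X [] _ = *-zeroʳ m
    sum-map-const-All m k X (x ∷ L) (p ∷ ps) = trans (*-distribˡ-+ m (k x) _) (cong₂ _+_ p (sum-map-const-All m k X L ps))

  module _ {n : ℕ} where

    removeItem-head : ∀ (x : Fin n) xs → All (λ y → ¬ (x ≡ y)) xs → removeItem x (x ∷ xs) ≡ xs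
    removeItem-head x xs px with x ≟ᶠ x
    ... | yes _ = filter-all (λ j → ¬? (x ≟ᶠ j)) px
    ... | no ne = ⊥-elim (ne refl)

    removeItem-∷ : ∀ (i x : Fin n) xs → ¬ (i ≡ x) → removeItem i (x ∷ xs) ≡ x ∷ removeItem i xs
    removeItem-∷ i x xs ne with i ≟ᶠ x
    ... | yes e = ⊥-elim (ne e)
    ... | no _ = refl

    All-∈-self : ∀ (S : List (Fin n)) → All (_∈ S) S
    All-∈-self S = All.tabulate (λ i∈S → i∈S)

    All≢⇒≢ : ∀ {x : Fin n} {xs} {i} → All (λ y → ¬ (x ≡ y)) xs → i ∈ xs → ¬ (i ≡ x)
    All≢⇒≢ (px ∷ _) (here refl) e = px (sym e)
    All≢⇒≢ (_ ∷ pxs) (there p) e = All≢⇒≢ pxs p e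

    sumPicks-unique : ∀ (g : Fin n → List (Fin n) → ℕ) S → Unique S → sumPicks g S ≡ sum (map (λ i → g i (removeItem i S)) S)
    sumPicks-unique g [] _ = refl
    sumPicks-unique g (x ∷ xs) (px ∷ uxs) = cong₂ _+_ (cong (g x) (sym (removeItem-head x xs px)))
      (trans (sumPicks-unique (λ y ys → g y (x ∷ ys)) xs uxs)
        (sum-map-cong-All _ _ xs (All.map (λ {i} ie → cong (g i) (sym (removeItem-∷ i x xs (All≢⇒≢ px ie)))) (All-∈-self xs))))

    removeItem-unique : ∀ (i : Fin n) S → Unique S → Unique (removeItem i S)
    removeItem-unique i S u = Unique.filter⁺ {P = λ j → ¬ (i ≡ j)} (λ j → ¬? (i ≟ᶠ j)) u

    removeItem-↭ : ∀ (i : Fin n) S → Unique S → i ∈ S → S ↭ (i ∷ removeItem i S)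
    removeItem-↭ i (x ∷ xs) (px ∷ _) (here refl) rewrite removeItem-head x xs px = Perm.refl
    removeItem-↭ i (x ∷ xs) (px ∷ u) (there p) rewrite removeItem-∷ i x xs (All≢⇒≢ px p) =
      Perm.trans (Perm.prep x (removeItem-↭ i xs u p)) (Perm.swap x i Perm.refl)

    length-removeItem : ∀ (i : Fin n) S → Unique S → i ∈ S → length S ≡ suc (length (removeItem i S))
    length-removeItem i S u ie = PermP.↭-length (removeItem-↭ i S u ie)

    ∈-removeItem : ∀ {i x : Fin n} {S} → i ∈ S → ¬ (x ≡ i) → i ∈ removeItem x S
    ∈-removeItem {i} {x} ie ne = ∈-filter⁺ (λ j → ¬? (x ≟ᶠ j)) ie ne

    ↭-complement : ∀ (C S : List (Fin n)) → Unique C → Unique S → All (λ i → i ∈ S) C → Σ (List (Fin n)) (λ rest → S ↭ (C ++ rest))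
    ↭-complement [] S _ _ _ = S , Perm.refl
    ↭-complement (c0 ∷ C) S (pc ∷ uc) uS (c0∈ ∷ aC)
      with ↭-complement C (removeItem c0 S) uc (removeItem-unique c0 S uS) (All.zipWith (λ (c0≢i , i∈S) → ∈-removeItem i∈S c0≢i) (pc , aC))
    ... | rest , pr = rest , Perm.trans (removeItem-↭ c0 S uS c0∈) (Perm.prep c0 pr)

module Lifetimes where

  open import Data.Nat
  open import Data.Nat.Properties
  open import Data.Fin using (Fin)
  open import Data.List using (List; []; _∷_; length; map; catMaybes)
  open import Data.List.Relation.Binary.Pointwise as Pointwise using (Pointwise; []; _∷_)
  open import Relation.Binary.PropositionalEquality
  open import Data.Bool using (T)
  open import Data.Product using (_,_)
  open import Data.Maybe using (just; nothing)
  open import Defs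
  open Greedy
  open Staircase using (upFrom)

  -- The last step at which item i is active; items that are never deleted live until the horizon big.
  lifetime : ∀ {n} → DecInstance n → ℕ → Fin n → ℕ
  lifetime del big i with del i
  ... | nothing = big
  ... | just s = pred s

  active-lifetime : ∀ {n} (del : DecInstance n) big c i → c < big → active del (suc c) i ≡ (c <ᵇ lifetime del big i)
  active-lifetime del big c i lt with del i
  ... | nothing = sym (<⇒<ᵇ≡true lt)
  ... | just zero = refl
  ... | just (suc s) = refl

  upFrom-≤-upFrom-suc : ∀ a k → Pointwise _≤_ (upFrom a k) (upFrom (suc a) k)
  upFrom-≤-upFrom-suc a zero = []
  upFrom-≤-upFrom-suc a (suc k) = n≤1+n a ∷ upFrom-≤-upFrom-suc (suc a) k

  feasible⇒staircase≤lifetimes : ∀ {n} (del : DecInstance n) big c σ → ActiveSchedFrom del (suc c) σ → c + length σ ≤ big →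
    Pointwise _≤_ (upFrom (suc c) (length (catMaybes σ))) (map (lifetime del big) (catMaybes σ))
  feasible⇒staircase≤lifetimes del big c [] _ _ = []
  feasible⇒staircase≤lifetimes del big c (nothing ∷ σ) as lb =
    Pointwise.transitive ≤-trans (upFrom-≤-upFrom-suc (suc c) _) (feasible⇒staircase≤lifetimes del big (suc c) σ as (subst (_≤ big) (+-suc c (length σ)) lb))
  feasible⇒staircase≤lifetimes del big c (just i ∷ σ) (act , as) lb =
    <ᵇ⇒< c (lifetime del big i) (subst T (active-lifetime del big c i c<big) act) ∷ feasible⇒staircase≤lifetimes del big (suc c) σ as (subst (_≤ big) (+-suc c (length σ)) lb)
    where
    c<big : c < big
    c<big = <-≤-trans (m<m+n c z<s) lb


module GreedyRecursion where

  open import Data.Nat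
  open import Data.Nat.Properties
  open import Data.Nat.ListAction using (sum)
  open import Data.Fin using (Fin)
  open import Data.List using (List; []; _∷_; length; map; filterᵇ)
  open import Data.List.Properties using (length-map)
  open import Data.List.Relation.Unary.All using (All)
  import Data.List.Relation.Unary.All as All
  import Data.List.Relation.Unary.All.Properties as All
  open import Data.List.Membership.Propositional using (_∈_)
  open import Data.List.Relation.Unary.Unique.Propositional using (Unique)
  import Data.List.Relation.Binary.Permutation.Propositional.Properties as PermP
  open import Relation.Binary.PropositionalEquality
  open import Data.Bool using (true; false; if_then_else_; not)
  open import Data.Product using (_,_)
  open import Defs
  open PermutationSums
  open Greedy
  open ItemLists
  open Lifetimes

  totalGreedy : ∀ {n} → DecInstance n → ℕ → ℕ → List (Fin n) → ℕ
  totalGreedy del big c S = sumPerms (greedy c) (map (lifetime del big) S)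

  totalGreedy-noPending : ∀ {n} (del : DecInstance n) big c (S : List (Fin n)) → c < big →
    filterᵇ (active del (suc c)) S ≡ [] → totalGreedy del big c S ≡ length S ! * c
  totalGreedy-noPending del big c S c<big none = begin
      sumPerms (greedy c) (map ℓ S)
    ≡⟨ sumPerms-allDead c (map ℓ S) (All.map⁺ (All.map dead (filter-[] (active del (suc c)) S none))) ⟩
      length (map ℓ S) ! * c
    ≡⟨ cong (λ z → z ! * c) (length-map ℓ S) ⟩
      length S ! * c
    ∎
    where
    open ≡-Reasoning
    ℓ = lifetime del big
    dead : ∀ {i} → active del (suc c) i ≡ false → ℓ i ≤ c
    dead {i} inactive = <ᵇ≡false⇒≥ {c} {ℓ i} (trans (sym (active-lifetime del big c i c<big)) inactive)

  firstPick : ∀ {n} → DecInstance n → ℕ → ℕ → List (Fin n) → Fin n → ℕ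
  firstPick del big c S i = sumPerms (greedy (greedyStep c (lifetime del big i))) (map (lifetime del big) (removeItem i S))

  totalGreedy-byFirst : ∀ {n} (del : DecInstance n) big c (s0 : Fin n) ss → Unique (s0 ∷ ss) →
    totalGreedy del big c (s0 ∷ ss) ≡ sum (map (firstPick del big c (s0 ∷ ss)) (s0 ∷ ss))
  totalGreedy-byFirst del big c s0 ss u =
    trans (sumPerms-byHead (greedy c) (ℓ s0) (map ℓ ss))
      (trans (sumPicks-map ℓ (λ y ys → sumPerms (greedy (greedyStep c y)) ys) (s0 ∷ ss))
        (sumPicks-unique (λ i Q → sumPerms (greedy (greedyStep c (ℓ i))) (map ℓ Q)) (s0 ∷ ss) u))
    where ℓ = lifetime del big

  firstPick-pending : ∀ {n} (del : DecInstance n) big c S {i} → c < big → active del (suc c) i ≡ true →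
    firstPick del big c S i ≡ totalGreedy del big (suc c) (removeItem i S)
  firstPick-pending del big c S {i} c<big pending =
    cong (λ z → sumPerms (greedy z) (map (lifetime del big) (removeItem i S)))
      (cong (λ w → if w then suc c else c) (trans (sym (active-lifetime del big c i c<big)) pending))

  firstPick-dead : ∀ {n} (del : DecInstance n) big c S {i} → Unique S → c < big → i ∈ S → active del (suc c) i ≡ false →
    length S * firstPick del big c S i ≡ totalGreedy del big c S
  firstPick-dead del big c S {i} u c<big i∈S dead = sym (begin
      sumPerms (greedy c) (map ℓ S)
    ≡⟨ sumPerms-↭ (greedy c) (PermP.map⁺ ℓ (removeItem-↭ i S u i∈S)) ⟩
      sumPerms (greedy c) (ℓ i ∷ map ℓ (removeItem i S))
    ≡⟨ sumPerms-dead-head (ℓ i) c (map ℓ (removeItem i S)) (<ᵇ≡false⇒≥ {c} {ℓ i} ℓi≤c) ⟩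
      suc (length (map ℓ (removeItem i S))) * sumPerms (greedy c) (map ℓ (removeItem i S))
    ≡⟨ cong₂ _*_ len (cong (λ z → sumPerms (greedy z) (map ℓ (removeItem i S))) (sym noStep)) ⟩
      length S * firstPick del big c S i
    ∎)
    where
    open ≡-Reasoning
    ℓ = lifetime del big
    ℓi≤c : (c <ᵇ ℓ i) ≡ false
    ℓi≤c = trans (sym (active-lifetime del big c i c<big)) dead
    noStep : greedyStep c (ℓ i) ≡ c
    noStep = cong (λ w → if w then suc c else c) ℓi≤c
    len : suc (length (map ℓ (removeItem i S))) ≡ length S
    len = trans (cong suc (length-map ℓ (removeItem i S))) (sym (length-removeItem i S u i∈S))

  -- Splitting by the first item, the dead ones contribute the average, which leaves the pending ones.
  totalGreedy-rec : ∀ {n} (del : DecInstance n) big c (s0 : Fin n) ss → Unique (s0 ∷ ss) → c + length (s0 ∷ ss) ≤ big →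
    length (filterᵇ (active del (suc c)) (s0 ∷ ss)) * totalGreedy del big c (s0 ∷ ss)
      ≡ length (s0 ∷ ss) * sum (map (λ i → totalGreedy del big (suc c) (removeItem i (s0 ∷ ss))) (filterᵇ (active del (suc c)) (s0 ∷ ss)))
  totalGreedy-rec {n} del big c s0 ss u lb = +-cancelʳ-≡ _ _ _ (begin
      length L * T + length D * T
    ≡⟨ sym (*-distribʳ-+ T (length L) (length D)) ⟩
      (length L + length D) * T
    ≡⟨ cong (_* T) (sym (length-filter-split b S)) ⟩
      m * T
    ≡⟨ cong (m *_) (trans (totalGreedy-byFirst del big c s0 ss u) (sum-filter-split b k S)) ⟩
      m * (sum (map k L) + sum (map k D))
    ≡⟨ *-distribˡ-+ m (sum (map k L)) (sum (map k D)) ⟩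
      m * sum (map k L) + m * sum (map k D)
    ≡⟨ cong₂ _+_ (cong (m *_) pendingPart) deadPart ⟩
      m * sum (map F L) + length D * T
    ∎)
    where
    open ≡-Reasoning
    S = s0 ∷ ss
    m = length S
    b = active del (suc c)
    L = filterᵇ b S
    D = filterᵇ (λ i → not (b i)) S
    T = totalGreedy del big c S
    F : Fin n → ℕ
    F i = totalGreedy del big (suc c) (removeItem i S)
    k = firstPick del big c S
    c<big : c < big
    c<big = <-≤-trans (m<m+n c z<s) lb
    pendingPart : sum (map k L) ≡ sum (map F L)
    pendingPart = sum-map-cong-All k F L (All.map (firstPick-pending del big c S c<big) (filter-true b S))
    deadPart : m * sum (map k D) ≡ length D * T
    deadPart = sum-map-const-All m k T D
      (All.zipWith (λ (i∈S , dead) → firstPick-dead del big c S u c<big i∈S dead) (filter-All (λ i → not (b i)) S (All-∈-self S) , filter-false b S))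


module UniRandAsGreedy where

  open import Data.Nat as ℕ using (ℕ; zero; suc; _≤_; s≤s; z<s; _!)
  import Data.Nat.Properties as ℕP
  open import Data.Nat.ListAction using (sum)
  open import Data.Fin using (Fin)
  open import Data.List using (List; []; _∷_; length; map; filterᵇ)
  open import Data.List.Relation.Unary.All as All using (All; []; _∷_)
  open import Data.List.Membership.Propositional using (_∈_)
  open import Data.List.Relation.Unary.Unique.Propositional using (Unique)
  open import Relation.Binary.PropositionalEquality
  open import Data.Integer using () renaming (+_ to pos)
  open import Data.Rational using (ℚ; 0ℚ; 1ℚ; _+_; _*_; _-_; _/_)
  import Data.Rational.Properties as ℚP
  open import Data.Rational.Solver
  open +-*-Solver
  open import Defs
  open ItemLists
  open Rationals
  open GreedyRecursion

  module _ {A : Set} where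
    sumℚ-cong-All : ∀ (f g : A → ℚ) L → All (λ i → f i ≡ g i) L → sumℚ (map f L) ≡ sumℚ (map g L)
    sumℚ-cong-All f g [] _ = refl
    sumℚ-cong-All f g (x ∷ L) (p ∷ ps) = cong₂ _+_ p (sumℚ-cong-All f g L ps)

    sumℚ-ℕtoℚ : ∀ (g : A → ℕ) L → sumℚ (map (λ i → ℕtoℚ (g i)) L) ≡ ℕtoℚ (sum (map g L))
    sumℚ-ℕtoℚ g [] = refl
    sumℚ-ℕtoℚ g (x ∷ L) = trans (cong (ℕtoℚ (g x) +_) (sumℚ-ℕtoℚ g L)) (sym (ℕtoℚ-+ (g x) (sum (map g L))))

    sumℚ-affine : ∀ (a b : ℚ) (U : A → ℚ) L → sumℚ (map (λ i → a * (U i + b)) L) ≡ a * sumℚ (map U L) + ℕtoℚ (length L) * (a * b)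
    sumℚ-affine a b U [] = solve 2 (λ a b → con 0ℚ := a :* con 0ℚ :+ con 0ℚ :* (a :* b)) refl a b
    sumℚ-affine a b U (x ∷ L) = begin
        a * (U x + b) + sumℚ (map (λ i → a * (U i + b)) L)
      ≡⟨ cong (a * (U x + b) +_) (sumℚ-affine a b U L) ⟩
        a * (U x + b) + (a * sumℚ (map U L) + ℕtoℚ (length L) * (a * b))
      ≡⟨ solve 5 (λ a b u w l → a :* (u :+ b) :+ (a :* w :+ l :* (a :* b)) := a :* (u :+ w) :+ (con 1ℚ :+ l) :* (a :* b))
           refl a b (U x) (sumℚ (map U L)) (ℕtoℚ (length L)) ⟩
        a * (U x + sumℚ (map U L)) + (1ℚ + ℕtoℚ (length L)) * (a * b)
      ≡⟨ cong (λ z → a * (U x + sumℚ (map U L)) + z * (a * b)) (sym (ℕtoℚ-+ 1 (length L))) ⟩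
        a * (U x + sumℚ (map U L)) + ℕtoℚ (suc (length L)) * (a * b)
      ∎
      where open ≡-Reasoning

  -- The algebra of one UniRand step: s = length S, g = (s - 1)!, p = number of pending items,
  -- W = sum of their expected continuations, T = totalGreedy of S, Σ = sum of totalGreedy after each pick.
  uniRandStep-identity : ∀ (s g c p p⁻¹ W T Σ : ℚ) → g * W + p * (g * (1ℚ + c)) ≡ Σ → p * T ≡ s * Σ → p⁻¹ * p ≡ 1ℚ →
    s * g * ((1ℚ + p⁻¹ * W) + c) ≡ T
  uniRandStep-identity s g c p p⁻¹ W T Σ e1 e2 inv = begin
      s * g * ((1ℚ + p⁻¹ * W) + c)
    ≡⟨ solve 6 (λ s g c p p⁻¹ W → s :* g :* ((con 1ℚ :+ p⁻¹ :* W) :+ c)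
         := s :* p⁻¹ :* (g :* W :+ p :* (g :* (con 1ℚ :+ c))) :+ s :* g :* (con 1ℚ :+ c) :* (con 1ℚ :- p⁻¹ :* p)) refl s g c p p⁻¹ W ⟩
      s * p⁻¹ * (g * W + p * (g * (1ℚ + c))) + s * g * (1ℚ + c) * (1ℚ - p⁻¹ * p)
    ≡⟨ cong₂ (λ z w → s * p⁻¹ * z + s * g * (1ℚ + c) * (1ℚ - w)) e1 inv ⟩
      s * p⁻¹ * Σ + s * g * (1ℚ + c) * (1ℚ - 1ℚ)
    ≡⟨ solve 5 (λ s g c p⁻¹ Σ → s :* p⁻¹ :* Σ :+ s :* g :* (con 1ℚ :+ c) :* (con 1ℚ :- con 1ℚ) := p⁻¹ :* (s :* Σ)) refl s g c p⁻¹ Σ ⟩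
      p⁻¹ * (s * Σ)
    ≡⟨ cong (p⁻¹ *_) (sym e2) ⟩
      p⁻¹ * (p * T)
    ≡⟨ sym (ℚP.*-assoc p⁻¹ p T) ⟩
      p⁻¹ * p * T
    ≡⟨ cong (_* T) inv ⟩
      1ℚ * T
    ≡⟨ ℚP.*-identityˡ T ⟩
      T
    ∎
    where open ≡-Reasoning

  uniRand≡averageGreedy : ∀ {n} (del : DecInstance n) big f c (S : List (Fin n)) → Unique S → length S ≤ f → c ℕ.+ length S ≤ big →
    ℕtoℚ (length S !) * (uniRandFrom del f (suc c) S + ℕtoℚ c) ≡ ℕtoℚ (totalGreedy del big c S)
  uniRand≡averageGreedy del big zero c [] u le lb = trans (ℚP.*-identityˡ _) (ℚP.+-identityˡ _)
  uniRand≡averageGreedy del big (suc f) c [] u le lb = trans (ℚP.*-identityˡ _) (ℚP.+-identityˡ _)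
  uniRand≡averageGreedy {n} del big (suc f) c (s0 ∷ ss) u (s≤s le) lb with filterᵇ (active del (suc c)) (s0 ∷ ss) in eqP
  ... | [] = trans (cong (ℕtoℚ (length S !) *_) (ℚP.+-identityˡ (ℕtoℚ c)))
            (trans (sym (ℕtoℚ-* (length S !) c)) (cong ℕtoℚ (sym (totalGreedy-noPending del big c S (ℕP.<-≤-trans (ℕP.m<m+n c z<s) lb) eqP))))
    where S = s0 ∷ ss
  ... | x ∷ xs =
    trans (cong (λ z → z * ((1ℚ + (pos 1 / suc (length xs)) * sumℚ (map U P)) + ℕtoℚ c)) (ℕtoℚ-* (length S) (length ss !)))
      (uniRandStep-identity (ℕtoℚ (length S)) g (ℕtoℚ c) (ℕtoℚ (suc (length xs))) (pos 1 / suc (length xs)) (sumℚ (map U P))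
         (ℕtoℚ (totalGreedy del big c S)) (ℕtoℚ (sum (map F P))) continuations averaging ([1/n]*n≡1 (suc (length xs))))
    where
    S = s0 ∷ ss
    b = active del (suc c)
    P = x ∷ xs
    U : Fin n → ℚ
    U i = uniRandFrom del f (suc (suc c)) (removeItem i S)
    F : Fin n → ℕ
    F i = totalGreedy del big (suc c) (removeItem i S)
    g = ℕtoℚ (length ss !)
    pending∈S : All (λ i → i ∈ S) P
    pending∈S = subst (All (λ i → i ∈ S)) eqP (filter-All {P = λ i → i ∈ S} b S (All-∈-self S))
    induction : ∀ {i} → i ∈ S → g * (U i + ℕtoℚ (suc c)) ≡ ℕtoℚ (F i)
    induction {i} ie = trans (cong (λ z → ℕtoℚ (z !) * (U i + ℕtoℚ (suc c))) (ℕP.suc-injective (length-removeItem i S u ie)))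
      (uniRand≡averageGreedy del big f (suc c) (removeItem i S) (removeItem-unique i S u)
        (subst (_≤ f) (ℕP.suc-injective (length-removeItem i S u ie)) le)
        (subst (_≤ big) (trans (ℕP.+-suc c (length ss)) (cong (λ z → suc (c ℕ.+ z)) (ℕP.suc-injective (length-removeItem i S u ie)))) lb))
    continuations : g * sumℚ (map U P) + ℕtoℚ (suc (length xs)) * (g * (1ℚ + ℕtoℚ c)) ≡ ℕtoℚ (sum (map F P))
    continuations = trans (cong (λ z → g * sumℚ (map U P) + ℕtoℚ (suc (length xs)) * (g * z)) (sym (ℕtoℚ-+ 1 c)))
          (trans (sym (sumℚ-affine g (ℕtoℚ (suc c)) U P))
            (trans (sumℚ-cong-All _ _ P (All.map induction pending∈S)) (sumℚ-ℕtoℚ F P)))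
    recursion = totalGreedy-rec del big c s0 ss u lb
    averaging : ℕtoℚ (suc (length xs)) * ℕtoℚ (totalGreedy del big c S) ≡ ℕtoℚ (length S) * ℕtoℚ (sum (map F P))
    averaging = trans (sym (ℕtoℚ-* (suc (length xs)) (totalGreedy del big c S))) (trans (cong ℕtoℚ
           (subst (λ L → length L ℕ.* totalGreedy del big c S ≡ length S ℕ.* sum (map F L)) eqP recursion)) (ℕtoℚ-* (length S) (sum (map F P))))


module InverseFactorials where

  open import Data.Nat as ℕ using (ℕ; zero; suc; _!)
  open import Data.Nat.Properties using (_!≢0)
  open import Data.Integer using () renaming (+_ to pos)
  open import Data.Rational using (ℚ; 0ℚ; 1ℚ; _*_; -_; _≤_; _/_)
  import Data.Rational.Properties as ℚP
  open import Data.Rational.Solver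
  open +-*-Solver
  open import Relation.Binary.PropositionalEquality
  open import Data.Sum using (_⊎_; inj₁; inj₂)
  open import Defs
  open Rationals

  invFact : ℕ → ℚ
  invFact n = pos 1 / n !
    where instance _ = n !≢0

  sign : ℕ → ℚ
  sign zero = 1ℚ
  sign (suc n) = - sign n

  sign-suc-suc : ∀ n → sign (suc (suc n)) ≡ sign n
  sign-suc-suc n = solve 1 (λ x → :- (:- x) := x) refl (sign n)

  sign-±1 : ∀ n → (sign n ≡ 1ℚ) ⊎ (sign n ≡ - 1ℚ)
  sign-±1 zero = inj₁ refl
  sign-±1 (suc n) with sign-±1 n
  ... | inj₁ e = inj₂ (cong -_ e)
  ... | inj₂ e = inj₁ (cong -_ e)

  0≤invFact : ∀ n → 0ℚ ≤ invFact n
  0≤invFact n = ℚP.nonNegative⁻¹ (invFact n) {{ℚP.normalize-nonNeg 1 (n !) {{n !≢0}}}}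

  invFact*! : ∀ n → invFact n * ℕtoℚ (n !) ≡ 1ℚ
  invFact*! n = [1/n]*n≡1 (n !) {{n !≢0}}

  invFact-suc*suc : ∀ n → invFact (suc n) * ℕtoℚ (suc n) ≡ invFact n
  invFact-suc*suc n = begin
      X * ℕtoℚ (suc n)
    ≡⟨ sym (ℚP.*-identityʳ _) ⟩
      X * ℕtoℚ (suc n) * 1ℚ
    ≡⟨ cong (λ z → X * ℕtoℚ (suc n) * z) (sym (trans (ℚP.*-comm (ℕtoℚ (n !)) (invFact n)) (invFact*! n))) ⟩
      X * ℕtoℚ (suc n) * (ℕtoℚ (n !) * invFact n)
    ≡⟨ solve 4 (λ x s f i → x :* s :* (f :* i) := x :* (s :* f) :* i) refl X (ℕtoℚ (suc n)) (ℕtoℚ (n !)) (invFact n) ⟩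
      X * (ℕtoℚ (suc n) * ℕtoℚ (n !)) * invFact n
    ≡⟨ cong (λ z → X * z * invFact n) (sym (ℕtoℚ-* (suc n) (n !))) ⟩
      X * ℕtoℚ (suc n !) * invFact n
    ≡⟨ cong (_* invFact n) (invFact*! (suc n)) ⟩
      1ℚ * invFact n
    ≡⟨ ℚP.*-identityˡ (invFact n) ⟩
      invFact n
    ∎
    where
    open ≡-Reasoning
    X = invFact (suc n)

  1/[1+_] : ℕ → ℚ
  1/[1+ n ] = pos 1 / suc n

  0≤1/[1+n] : ∀ n → 0ℚ ≤ 1/[1+ n ]
  0≤1/[1+n] n = ℚP.nonNegative⁻¹ (1/[1+ n ]) {{ℚP.normalize-nonNeg 1 (suc n)}}

  1/[1+n]*[1+n]≡1 : ∀ n → 1/[1+ n ] * ℕtoℚ (suc n) ≡ 1ℚ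
  1/[1+n]*[1+n]≡1 n = [1/n]*n≡1 (suc n)

  invFact-suc : ∀ n → invFact (suc n) ≡ 1/[1+ n ] * invFact n
  invFact-suc n = begin
      invFact (suc n)
    ≡⟨ sym (ℚP.*-identityʳ _) ⟩
      invFact (suc n) * 1ℚ
    ≡⟨ cong (invFact (suc n) *_) (sym (1/[1+n]*[1+n]≡1 n)) ⟩
      invFact (suc n) * (1/[1+ n ] * ℕtoℚ (suc n))
    ≡⟨ solve 3 (λ x ρ s → x :* (ρ :* s) := ρ :* (x :* s)) refl (invFact (suc n)) (1/[1+ n ]) (ℕtoℚ (suc n)) ⟩
      1/[1+ n ] * (invFact (suc n) * ℕtoℚ (suc n))
    ≡⟨ cong (1/[1+ n ] *_) (invFact-suc*suc n) ⟩
      1/[1+ n ] * invFact n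
    ∎
    where open ≡-Reasoning

  invFact≡suc*invFact-suc : ∀ n → invFact n ≡ ℕtoℚ (suc n) * invFact (suc n)
  invFact≡suc*invFact-suc n = trans (sym (invFact-suc*suc n)) (ℚP.*-comm (invFact (suc n)) (ℕtoℚ (suc n)))


module ExpCauchyProduct where

  open import Data.Nat as ℕ using (ℕ; zero; suc)
  import Data.Nat.Properties as ℕP
  open import Data.Rational using (ℚ; 0ℚ; 1ℚ; _+_; _*_; _-_; -_; _≤_)
  import Data.Rational.Properties as ℚP
  open import Data.Rational.Solver
  open +-*-Solver
  open import Relation.Binary.PropositionalEquality
  open import Data.Sum using (inj₁; inj₂)
  open import Defs
  open Rationals
  open RationalSums
  open InverseFactorials

  eInvApprox : ℕ → ℚ
  eInvApprox K = sumToℚ (suc K) (λ i → sign i * invFact i)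

  eApprox≡sumToℚ : ∀ N → eApprox N ≡ sumToℚ (suc N) invFact
  eApprox≡sumToℚ zero = sym (ℚP.+-identityʳ 1ℚ)
  eApprox≡sumToℚ (suc N) = trans (cong (_+ invFact (suc N)) (eApprox≡sumToℚ N)) (sym (sumToℚ-last (suc N) invFact))

  -- Splitting a + b + 2 = (a + 1) + (b + 1) makes the terms (-1)^i/(i! j!) of eInvApprox K · eApprox K telescope,
  -- leaving 1 + Σ_{a<K} (cross K a − cross a K), whose terms are ≤ 0 when K is odd.
  cross : ℕ → ℕ → ℚ
  cross a b = sign a * 1/[1+ a ℕ.+ b ] * invFact a * invFact b

  product : ℕ → ℕ → ℚ
  product i j = sign i * invFact i * invFact j

  crossˡ : ℕ → ℕ → ℚ
  crossˡ zero j = 0ℚ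
  crossˡ (suc a) j = cross a j

  crossʳ : ℕ → ℕ → ℚ
  crossʳ i zero = 0ℚ
  crossʳ i (suc b) = cross i b

  δ₀ : ℕ → ℕ → ℚ
  δ₀ zero zero = 1ℚ
  δ₀ zero (suc j) = 0ℚ
  δ₀ (suc i) j = 0ℚ

  product-split : ∀ i j → product i j ≡ δ₀ i j + (- crossˡ i j + crossʳ i j)
  product-split zero zero = refl
  product-split zero (suc b) = begin
      1ℚ * 1ℚ * invFact (suc b)
    ≡⟨ cong (λ z → 1ℚ * 1ℚ * z) (invFact-suc b) ⟩
      1ℚ * 1ℚ * (1/[1+ b ] * invFact b)
    ≡⟨ solve 2 (λ ρ i → con 1ℚ :* con 1ℚ :* (ρ :* i) := con 0ℚ :+ (:- con 0ℚ :+ con 1ℚ :* ρ :* con 1ℚ :* i)) refl (1/[1+ b ]) (invFact b) ⟩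
      0ℚ + (- 0ℚ + 1ℚ * 1/[1+ b ] * 1ℚ * invFact b)
    ∎
    where open ≡-Reasoning
  product-split (suc a) zero = begin
      - sign a * invFact (suc a) * 1ℚ
    ≡⟨ cong (λ z → - sign a * z * 1ℚ) (trans (invFact-suc a) (cong (λ w → 1/[1+ w ] * invFact a) (sym (ℕP.+-identityʳ a)))) ⟩
      - sign a * (1/[1+ a ℕ.+ 0 ] * invFact a) * 1ℚ
    ≡⟨ solve 3 (λ s ρ i → :- s :* (ρ :* i) :* con 1ℚ := con 0ℚ :+ (:- (s :* ρ :* i :* con 1ℚ) :+ con 0ℚ)) refl (sign a) (1/[1+ a ℕ.+ 0 ]) (invFact a) ⟩
      0ℚ + (- (sign a * 1/[1+ a ℕ.+ 0 ] * invFact a * 1ℚ) + 0ℚ)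
    ∎
    where open ≡-Reasoning
  product-split (suc a) (suc b) = begin
      - sign a * invFact (suc a) * invFact (suc b)
    ≡⟨ sym (ℚP.*-identityʳ _) ⟩
      - sign a * invFact (suc a) * invFact (suc b) * 1ℚ
    ≡⟨ cong (λ z → - sign a * invFact (suc a) * invFact (suc b) * z) (sym one) ⟩
      - sign a * invFact (suc a) * invFact (suc b) * (R * (A1 + B1))
    ≡⟨ solve 6 (λ s x y R A1 B1 → :- s :* x :* y :* (R :* (A1 :+ B1))
         := con 0ℚ :+ (:- (s :* R :* (A1 :* x) :* y) :+ :- s :* R :* x :* (B1 :* y)))
         refl (sign a) (invFact (suc a)) (invFact (suc b)) R A1 B1 ⟩
      0ℚ + (- (sign a * R * (A1 * invFact (suc a)) * invFact (suc b)) + - sign a * R * invFact (suc a) * (B1 * invFact (suc b)))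
    ≡⟨ cong₂ (λ z w → 0ℚ + (- (sign a * z * w * invFact (suc b)) + - sign a * R * invFact (suc a) * (B1 * invFact (suc b))))
         (cong 1/[1+_] (sym (ℕP.+-suc a b))) (sym (invFact≡suc*invFact-suc a)) ⟩
      0ℚ + (- (sign a * 1/[1+ a ℕ.+ suc b ] * invFact a * invFact (suc b)) + - sign a * R * invFact (suc a) * (B1 * invFact (suc b)))
    ≡⟨ cong (λ z → 0ℚ + (- (sign a * 1/[1+ a ℕ.+ suc b ] * invFact a * invFact (suc b)) + - sign a * R * invFact (suc a) * z)) (sym (invFact≡suc*invFact-suc b)) ⟩
      0ℚ + (- (sign a * 1/[1+ a ℕ.+ suc b ] * invFact a * invFact (suc b)) + - sign a * R * invFact (suc a) * invFact b)
    ∎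
    where
    open ≡-Reasoning
    R = 1/[1+ suc (a ℕ.+ b) ]
    A1 = ℕtoℚ (suc a)
    B1 = ℕtoℚ (suc b)
    one : R * (A1 + B1) ≡ 1ℚ
    one = trans (cong (R *_) (trans (sym (ℕtoℚ-+ (suc a) (suc b))) (cong (λ z → ℕtoℚ (suc z)) (ℕP.+-suc a b)))) (1/[1+n]*[1+n]≡1 (suc (a ℕ.+ b)))

  doubleSum : ℕ → (ℕ → ℕ → ℚ) → ℚ
  doubleSum K G = sumToℚ (suc K) (λ i → sumToℚ (suc K) (λ j → G i j))

  doubleSum-lin : ∀ K (A B C : ℕ → ℕ → ℚ) → doubleSum K (λ i j → A i j + (- B i j + C i j)) ≡ doubleSum K A + (- doubleSum K B + doubleSum K C)
  doubleSum-lin K A B C = begin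
      sumToℚ (suc K) (λ i → sumToℚ (suc K) (λ j → A i j + (- B i j + C i j)))
    ≡⟨ sumToℚ-cong (suc K) _ _ (λ i → trans (sumToℚ-+ (suc K) (A i) (λ j → - B i j + C i j))
         (cong (sumToℚ (suc K) (A i) +_) (trans (sumToℚ-+ (suc K) (λ j → - B i j) (C i)) (cong (_+ sumToℚ (suc K) (C i)) (sumToℚ-neg (suc K) (B i)))))) ⟩
      sumToℚ (suc K) (λ i → sumToℚ (suc K) (A i) + (- sumToℚ (suc K) (B i) + sumToℚ (suc K) (C i)))
    ≡⟨ trans (sumToℚ-+ (suc K) (λ i → sumToℚ (suc K) (A i)) (λ i → - sumToℚ (suc K) (B i) + sumToℚ (suc K) (C i)))
         (cong (doubleSum K A +_) (trans (sumToℚ-+ (suc K) (λ i → - sumToℚ (suc K) (B i)) (λ i → sumToℚ (suc K) (C i)))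
           (cong (_+ doubleSum K C) (sumToℚ-neg (suc K) (λ i → sumToℚ (suc K) (B i)))))) ⟩
      doubleSum K A + (- doubleSum K B + doubleSum K C)
    ∎
    where open ≡-Reasoning

  doubleSum-δ₀ : ∀ K → doubleSum K δ₀ ≡ 1ℚ
  doubleSum-δ₀ K = trans (cong₂ _+_ (trans (cong (1ℚ +_) (sumToℚ-zero K)) (ℚP.+-identityʳ 1ℚ))
             (trans (sumToℚ-cong K _ (λ _ → 0ℚ) (λ i → sumToℚ-zero (suc K))) (sumToℚ-zero K))) (ℚP.+-identityʳ 1ℚ)

  doubleSum-crossˡ : ∀ K → doubleSum K crossˡ ≡ sumToℚ K (λ a → sumToℚ K (cross a)) + sumToℚ K (λ a → cross a K)
  doubleSum-crossˡ K = trans (cong₂ _+_ (sumToℚ-zero (suc K)) refl)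
    (trans (ℚP.+-identityˡ _) (trans (sumToℚ-cong K _ _ (λ a → sumToℚ-last K (cross a))) (sumToℚ-+ K (λ a → sumToℚ K (cross a)) (λ a → cross a K))))

  doubleSum-crossʳ : ∀ K → doubleSum K crossʳ ≡ sumToℚ K (λ a → sumToℚ K (cross a)) + sumToℚ K (cross K)
  doubleSum-crossʳ K = trans (sumToℚ-cong (suc K) _ (λ i → sumToℚ K (cross i)) (λ i → ℚP.+-identityˡ _)) (sumToℚ-last K (λ i → sumToℚ K (cross i)))

  cross-antisym≤0 : ∀ K a → sign K ≡ - 1ℚ → cross K a + - cross a K ≤ 0ℚ
  cross-antisym≤0 K a sK = subst (_≤ 0ℚ) (sym eq) (ℚP.neg-antimono-≤ 0≤[1+sign]*P)
    where
    P = 1/[1+ a ℕ.+ K ] * invFact a * invFact K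
    eq : cross K a + - cross a K ≡ - ((1ℚ + sign a) * P)
    eq = begin
        sign K * 1/[1+ K ℕ.+ a ] * invFact K * invFact a + - (sign a * 1/[1+ a ℕ.+ K ] * invFact a * invFact K)
      ≡⟨ cong₂ (λ z w → z * 1/[1+ w ] * invFact K * invFact a + - (sign a * 1/[1+ a ℕ.+ K ] * invFact a * invFact K)) sK (ℕP.+-comm K a) ⟩
        - 1ℚ * 1/[1+ a ℕ.+ K ] * invFact K * invFact a + - (sign a * 1/[1+ a ℕ.+ K ] * invFact a * invFact K)
      ≡⟨ solve 4 (λ s ρ x y → :- con 1ℚ :* ρ :* y :* x :+ :- (s :* ρ :* x :* y) := :- ((con 1ℚ :+ s) :* (ρ :* x :* y)))
           refl (sign a) (1/[1+ a ℕ.+ K ]) (invFact a) (invFact K) ⟩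
        - ((1ℚ + sign a) * P)
      ∎
      where open ≡-Reasoning
    0≤1+sign : 0ℚ ≤ 1ℚ + sign a
    0≤1+sign with sign-±1 a
    ... | inj₁ e rewrite e = subst (0ℚ ≤_) (ℕtoℚ-+ 1 1) (ℕtoℚ-mono-≤ {0} {2} ℕ.z≤n)
    ... | inj₂ e rewrite e = ℚP.≤-refl
    0≤P : 0ℚ ≤ P
    0≤P = 0≤-* (0≤-* (0≤1/[1+n] (a ℕ.+ K)) (0≤invFact a)) (0≤invFact K)
    0≤[1+sign]*P : 0ℚ ≤ (1ℚ + sign a) * P
    0≤[1+sign]*P = 0≤-* 0≤1+sign 0≤P

  eApprox*eInvApprox≤1 : ∀ K → sign K ≡ - 1ℚ → eApprox K * eInvApprox K ≤ 1ℚ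
  eApprox*eInvApprox≤1 K sK = subst (_≤ 1ℚ) (sym eq) (subst (_≤ 1ℚ) (sym (ℚP.+-comm 1ℚ T)) T+1≤1)
    where
    X = sumToℚ K (λ a → sumToℚ K (cross a))
    A = sumToℚ K (λ a → cross a K)
    B = sumToℚ K (cross K)
    T = sumToℚ K (λ a → cross K a + - cross a K)
    T≡ : T ≡ B + - A
    T≡ = trans (sumToℚ-+ K (cross K) (λ a → - cross a K)) (cong (B +_) (sumToℚ-neg K (λ a → cross a K)))
    eq : eApprox K * eInvApprox K ≡ 1ℚ + T
    eq = begin
        eApprox K * eInvApprox K
      ≡⟨ trans (ℚP.*-comm (eApprox K) (eInvApprox K)) (cong (eInvApprox K *_) (eApprox≡sumToℚ K)) ⟩
        eInvApprox K * sumToℚ (suc K) invFact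
      ≡⟨ sumToℚ-*-sumToℚ (suc K) (suc K) (λ i → sign i * invFact i) invFact ⟩
        doubleSum K product
      ≡⟨ sumToℚ-cong (suc K) _ _ (λ i → sumToℚ-cong (suc K) _ _ (λ j → product-split i j)) ⟩
        doubleSum K (λ i j → δ₀ i j + (- crossˡ i j + crossʳ i j))
      ≡⟨ doubleSum-lin K δ₀ crossˡ crossʳ ⟩
        doubleSum K δ₀ + (- doubleSum K crossˡ + doubleSum K crossʳ)
      ≡⟨ cong₂ _+_ (doubleSum-δ₀ K) (cong₂ (λ z w → - z + w) (doubleSum-crossˡ K) (doubleSum-crossʳ K)) ⟩
        1ℚ + (- (X + A) + (X + B))
      ≡⟨ solve 3 (λ X A B → con 1ℚ :+ (:- (X :+ A) :+ (X :+ B)) := con 1ℚ :+ (B :+ :- A)) refl X A B ⟩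
        1ℚ + (B + - A)
      ≡⟨ cong (1ℚ +_) (sym T≡) ⟩
        1ℚ + T
      ∎
      where open ≡-Reasoning
    T≤0 : T ≤ 0ℚ
    T≤0 = subst (T ≤_) (sumToℚ-zero K) (sumToℚ-mono K _ _ (λ a → cross-antisym≤0 K a sK))
    T+1≤1 : T + 1ℚ ≤ 1ℚ
    T+1≤1 = subst (T + 1ℚ ≤_) (ℚP.+-identityˡ 1ℚ) (ℚP.+-monoˡ-≤ 1ℚ T≤0)


module DeficitBound where

  open import Data.Nat as ℕ using (ℕ; zero; suc; _⊔_)
  import Data.Nat.Properties as ℕP
  open import Data.Rational using (ℚ; 0ℚ; 1ℚ; _+_; _*_; _-_; -_; _≤_)
  import Data.Rational.Properties as ℚP
  open import Data.Rational.Solver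
  open +-*-Solver
  open import Relation.Binary.PropositionalEquality
  open import Data.Sum using (_⊎_; inj₁; inj₂)
  open import Data.Product using (Σ; _,_)
  open import Defs
  open Rationals
  open RationalSums
  open InverseFactorials
  open ExpCauchyProduct

  odd : ℕ → ℕ
  odd h = suc (h ℕ.+ h)

  odd-suc : ∀ h → odd (suc h) ≡ suc (suc (odd h))
  odd-suc h = cong suc (cong suc (ℕP.+-suc h h))

  sign-odd : ∀ h → sign (odd h) ≡ - 1ℚ
  sign-odd zero = refl
  sign-odd (suc h) = trans (cong sign (odd-suc h)) (trans (sign-suc-suc (odd h)) (sign-odd h))

  sign-even : ∀ h → sign (suc (odd h)) ≡ 1ℚ
  sign-even h = cong -_ (sign-odd h)

  eInvApprox-suc : ∀ m → eInvApprox (suc m) ≡ eInvApprox m + sign (suc m) * invFact (suc m)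
  eInvApprox-suc m = sumToℚ-last (suc m) (λ i → sign i * invFact i)

  1/[1+n]≤1 : ∀ n → 1/[1+ n ] ≤ 1ℚ
  1/[1+n]≤1 n = subst (_≤ 1ℚ) (ℚP.*-identityʳ (1/[1+ n ])) (subst (1/[1+ n ] * 1ℚ ≤_) (1/[1+n]*[1+n]≡1 n) (*-monoˡ-≤-0≤ (0≤1/[1+n] n) (ℕtoℚ-mono-≤ {1} {suc n} (ℕ.s≤s ℕ.z≤n))))

  1/[2+n]*2≤1 : ∀ n → 1/[1+ suc n ] * ℕtoℚ 2 ≤ 1ℚ
  1/[2+n]*2≤1 n = subst (1/[1+ suc n ] * ℕtoℚ 2 ≤_) (1/[1+n]*[1+n]≡1 (suc n)) (*-monoˡ-≤-0≤ (0≤1/[1+n] (suc n)) (ℕtoℚ-mono-≤ {2} {suc (suc n)} (ℕ.s≤s (ℕ.s≤s ℕ.z≤n))))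

  invFact-suc≤ : ∀ n → invFact (suc n) ≤ invFact n
  invFact-suc≤ n = subst (_≤ invFact n) (sym (invFact-suc n)) (subst (1/[1+ n ] * invFact n ≤_) (ℚP.*-identityˡ (invFact n)) (*-monoʳ-≤-0≤ (0≤invFact n) (1/[1+n]≤1 n)))

  eInvApprox-odd-suc : ∀ h → eInvApprox (odd (suc h)) ≡ eInvApprox (odd h) + (invFact (suc (odd h)) - invFact (suc (suc (odd h))))
  eInvApprox-odd-suc h = begin
      eInvApprox (odd (suc h))
    ≡⟨ cong eInvApprox (odd-suc h) ⟩
      eInvApprox (suc (suc (odd h)))
    ≡⟨ trans (eInvApprox-suc (suc (odd h))) (cong (_+ sign (suc (suc (odd h))) * invFact (suc (suc (odd h)))) (eInvApprox-suc (odd h))) ⟩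
      eInvApprox (odd h) + sign (suc (odd h)) * invFact (suc (odd h)) + sign (suc (suc (odd h))) * invFact (suc (suc (odd h)))
    ≡⟨ cong₂ (λ z w → eInvApprox (odd h) + z * invFact (suc (odd h)) + w * invFact (suc (suc (odd h)))) (sign-even h) (trans (sign-suc-suc (odd h)) (sign-odd h)) ⟩
      eInvApprox (odd h) + 1ℚ * invFact (suc (odd h)) + - 1ℚ * invFact (suc (suc (odd h)))
    ≡⟨ solve 3 (λ d x y → d :+ con 1ℚ :* x :+ :- con 1ℚ :* y := d :+ (x :- y)) refl (eInvApprox (odd h)) (invFact (suc (odd h))) (invFact (suc (suc (odd h)))) ⟩
      eInvApprox (odd h) + (invFact (suc (odd h)) - invFact (suc (suc (odd h))))
    ∎
    where open ≡-Reasoning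

  0≤invFact-invFact-suc : ∀ n → 0ℚ ≤ invFact n - invFact (suc n)
  0≤invFact-invFact-suc n = subst (_≤ invFact n - invFact (suc n)) (ℚP.+-inverseʳ (invFact (suc n))) (ℚP.+-monoˡ-≤ (- invFact (suc n)) (invFact-suc≤ n))

  eInvApprox-odd-mono-suc : ∀ h → eInvApprox (odd h) ≤ eInvApprox (odd (suc h))
  eInvApprox-odd-mono-suc h = subst (eInvApprox (odd h) ≤_) (sym (eInvApprox-odd-suc h))
    (subst (_≤ eInvApprox (odd h) + (invFact (suc (odd h)) - invFact (suc (suc (odd h))))) (ℚP.+-identityʳ (eInvApprox (odd h)))
      (ℚP.+-monoʳ-≤ (eInvApprox (odd h)) (0≤invFact-invFact-suc (suc (odd h)))))

  eInvApprox-odd-mono : ∀ h k → eInvApprox (odd h) ≤ eInvApprox (odd (k ℕ.+ h))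
  eInvApprox-odd-mono h zero = ℚP.≤-refl
  eInvApprox-odd-mono h (suc k) = ℚP.≤-trans (eInvApprox-odd-mono h k) (eInvApprox-odd-mono-suc (k ℕ.+ h))

  0≤eInvApprox-odd : ∀ h → 0ℚ ≤ eInvApprox (odd h)
  0≤eInvApprox-odd h = subst (λ z → eInvApprox (odd 0) ≤ eInvApprox (odd z)) (ℕP.+-identityʳ h) (eInvApprox-odd-mono 0 h)

  eApprox-mono-suc : ∀ N → eApprox N ≤ eApprox (suc N)
  eApprox-mono-suc N = subst (_≤ eApprox N + invFact (suc N)) (ℚP.+-identityʳ (eApprox N)) (ℚP.+-monoʳ-≤ (eApprox N) (0≤invFact (suc N)))

  eApprox-mono : ∀ N k → eApprox N ≤ eApprox (k ℕ.+ N)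
  eApprox-mono N zero = ℚP.≤-refl
  eApprox-mono N (suc k) = ℚP.≤-trans (eApprox-mono N k) (eApprox-mono-suc (k ℕ.+ N))

  0≤eApprox : ∀ N → 0ℚ ≤ eApprox N
  0≤eApprox N = ℚP.≤-trans (ℕtoℚ-mono-≤ {0} {1} ℕ.z≤n) (subst (λ z → eApprox 0 ≤ eApprox z) (ℕP.+-identityʳ N) (eApprox-mono 0 N))

  eApprox*eInvApprox-odd≤1 : ∀ N h → eApprox N * eInvApprox (odd h) ≤ 1ℚ
  eApprox*eInvApprox-odd≤1 N h = ℚP.≤-trans (*-monoʳ-≤-0≤ (0≤eInvApprox-odd h) eN≤eK) (ℚP.≤-trans (*-monoˡ-≤-0≤ (0≤eApprox K) dm≤dK) (eApprox*eInvApprox≤1 K (sign-odd Hm)))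
    where
    Hm = h ⊔ N
    K = odd Hm
    N≤K : N ℕ.≤ K
    N≤K = ℕP.≤-trans (ℕP.m≤n⊔m h N) (ℕP.≤-trans (ℕP.m≤m+n Hm Hm) (ℕP.n≤1+n _))
    eN≤eK : eApprox N ≤ eApprox K
    eN≤eK = subst (λ z → eApprox N ≤ eApprox z) (ℕP.m∸n+n≡m N≤K) (eApprox-mono N (K ℕ.∸ N))
    dm≤dK : eInvApprox (odd h) ≤ eInvApprox K
    dm≤dK = subst (λ z → eInvApprox (odd h) ≤ eInvApprox (odd z)) (ℕP.m∸n+n≡m (ℕP.m≤m⊔n h N)) (eInvApprox-odd-mono h (Hm ℕ.∸ h))

  -- The partial sums d_m = eInvApprox m of 1/e lie below 1/e for odd m, and d_{2h+1} + d_{2h+2} ≤ 2 d_{2h+3},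
  -- so summing them pairwise gives e · Σ_{m=1}^{k} d_m ≤ k.
  eInvApprox-pair≤ : ∀ h → eInvApprox (odd h) + eInvApprox (suc (odd h)) ≤ ℕtoℚ 2 * eInvApprox (odd (suc h))
  eInvApprox-pair≤ h = subst₂ _≤_ (sym lhs) (sym rhs) (ℚP.+-monoʳ-≤ (ℕtoℚ 2 * d) key)
    where
    d = eInvApprox (odd h)
    s = suc (odd h)
    lhs : d + eInvApprox s ≡ ℕtoℚ 2 * d + invFact s
    lhs = begin
        d + eInvApprox s
      ≡⟨ cong (d +_) (trans (eInvApprox-suc (odd h)) (cong (λ z → d + z * invFact s) (sign-even h))) ⟩
        d + (d + 1ℚ * invFact s)
      ≡⟨ solve 2 (λ d x → d :+ (d :+ con 1ℚ :* x) := (con 1ℚ :+ con 1ℚ) :* d :+ x) refl d (invFact s) ⟩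
        (1ℚ + 1ℚ) * d + invFact s
      ≡⟨ cong (λ z → z * d + invFact s) (sym (ℕtoℚ-+ 1 1)) ⟩
        ℕtoℚ 2 * d + invFact s
      ∎
      where open ≡-Reasoning
    rhs : ℕtoℚ 2 * eInvApprox (odd (suc h)) ≡ ℕtoℚ 2 * d + (ℕtoℚ 2 * invFact s - ℕtoℚ 2 * invFact (suc s))
    rhs = trans (cong (ℕtoℚ 2 *_) (eInvApprox-odd-suc h))
      (solve 4 (λ t d x y → t :* (d :+ (x :- y)) := t :* d :+ (t :* x :- t :* y)) refl (ℕtoℚ 2) d (invFact s) (invFact (suc s)))
    2*next≤ : ℕtoℚ 2 * invFact (suc s) ≤ invFact s
    2*next≤ = subst₂ _≤_ reorder (ℚP.*-identityˡ (invFact s)) (*-monoʳ-≤-0≤ (0≤invFact s) (1/[2+n]*2≤1 (odd h)))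
      where
      reorder : 1/[1+ s ] * ℕtoℚ 2 * invFact s ≡ ℕtoℚ 2 * invFact (suc s)
      reorder = trans (solve 3 (λ ρ t x → ρ :* t :* x := t :* (ρ :* x)) refl (1/[1+ s ]) (ℕtoℚ 2) (invFact s)) (cong (ℕtoℚ 2 *_) (sym (invFact-suc s)))
    key : invFact s ≤ ℕtoℚ 2 * invFact s - ℕtoℚ 2 * invFact (suc s)
    key = subst (_≤ ℕtoℚ 2 * invFact s - ℕtoℚ 2 * invFact (suc s)) 2x-x≡x (ℚP.+-monoʳ-≤ (ℕtoℚ 2 * invFact s) (ℚP.neg-antimono-≤ 2*next≤))
      where
      2x-x≡x : ℕtoℚ 2 * invFact s + - invFact s ≡ invFact s
      2x-x≡x = trans (cong (λ z → z * invFact s + - invFact s) (ℕtoℚ-+ 1 1)) (solve 1 (λ x → (con 1ℚ :+ con 1ℚ) :* x :+ :- x := x) refl (invFact s))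

  deficit : ℕ → ℚ
  deficit zero = 0ℚ
  deficit (suc k) = deficit k + eInvApprox (suc k)

  eApprox*eInvApprox-pair≤2 : ∀ N h → eApprox N * (eInvApprox (odd h) + eInvApprox (suc (odd h))) ≤ ℕtoℚ 2
  eApprox*eInvApprox-pair≤2 N h = ℚP.≤-trans (*-monoˡ-≤-0≤ (0≤eApprox N) (eInvApprox-pair≤ h))
    (subst (_≤ ℕtoℚ 2) (solve 3 (λ e t d → t :* (e :* d) := e :* (t :* d)) refl (eApprox N) (ℕtoℚ 2) (eInvApprox (odd (suc h))))
      (subst (ℕtoℚ 2 * (eApprox N * eInvApprox (odd (suc h))) ≤_) (ℚP.*-identityʳ (ℕtoℚ 2)) (*-monoˡ-≤-0≤ (0≤ℕtoℚ 2) (eApprox*eInvApprox-odd≤1 N (suc h)))))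

  eApprox*deficit-even≤ : ∀ N h → eApprox N * deficit (h ℕ.+ h) ≤ ℕtoℚ (h ℕ.+ h)
  eApprox*deficit-even≤ N zero = ℚP.≤-reflexive (ℚP.*-zeroʳ (eApprox N))
  eApprox*deficit-even≤ N (suc h) = subst (λ z → eApprox N * deficit z ≤ ℕtoℚ z) (sym (cong suc (ℕP.+-suc h h))) goal
    where
    E = eApprox N
    goal : E * deficit (suc (odd h)) ≤ ℕtoℚ (suc (odd h))
    goal = subst₂ _≤_ (sym lhs) (sym rhs) (ℚP.+-mono-≤ (eApprox*deficit-even≤ N h) (eApprox*eInvApprox-pair≤2 N h))
      where
      lhs : E * deficit (suc (odd h)) ≡ E * deficit (h ℕ.+ h) + E * (eInvApprox (odd h) + eInvApprox (suc (odd h)))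
      lhs = solve 4 (λ e u a b → e :* (u :+ a :+ b) := e :* u :+ e :* (a :+ b)) refl E (deficit (h ℕ.+ h)) (eInvApprox (odd h)) (eInvApprox (suc (odd h)))
      rhs : ℕtoℚ (suc (odd h)) ≡ ℕtoℚ (h ℕ.+ h) + ℕtoℚ 2
      rhs = trans (cong ℕtoℚ (ℕP.+-comm 2 (h ℕ.+ h))) (ℕtoℚ-+ (h ℕ.+ h) 2)

  eApprox*deficit-odd≤ : ∀ N h → eApprox N * deficit (odd h) ≤ ℕtoℚ (odd h)
  eApprox*deficit-odd≤ N h = subst₂ _≤_ (sym lhs) (sym rhs) (ℚP.+-mono-≤ (eApprox*deficit-even≤ N h) (eApprox*eInvApprox-odd≤1 N h))
    where
    lhs : eApprox N * deficit (odd h) ≡ eApprox N * deficit (h ℕ.+ h) + eApprox N * eInvApprox (odd h)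
    lhs = ℚP.*-distribˡ-+ (eApprox N) (deficit (h ℕ.+ h)) (eInvApprox (odd h))
    rhs : ℕtoℚ (odd h) ≡ ℕtoℚ (h ℕ.+ h) + 1ℚ
    rhs = trans (cong ℕtoℚ (ℕP.+-comm 1 (h ℕ.+ h))) (ℕtoℚ-+ (h ℕ.+ h) 1)

  even-or-odd : ∀ k → Σ ℕ (λ h → (k ≡ h ℕ.+ h) ⊎ (k ≡ odd h))
  even-or-odd zero = 0 , inj₁ refl
  even-or-odd (suc k) with even-or-odd k
  ... | h , inj₁ e = h , inj₂ (cong suc e)
  ... | h , inj₂ e = suc h , inj₁ (trans (cong suc e) (cong suc (sym (ℕP.+-suc h h))))

  eApprox*deficit≤ : ∀ N k → eApprox N * deficit k ≤ ℕtoℚ k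
  eApprox*deficit≤ N k with even-or-odd k
  ... | h , inj₁ e rewrite e = eApprox*deficit-even≤ N h
  ... | h , inj₂ e rewrite e = eApprox*deficit-odd≤ N h


module FallingFactorials where

  open import Data.Nat as ℕ using (ℕ; zero; suc; _!; _∸_)
  import Data.Nat.Properties as ℕP
  open import Data.Rational using (ℚ; 0ℚ; 1ℚ; _*_; _≤_)
  import Data.Rational.Properties as ℚP
  open import Data.Rational.Solver
  open +-*-Solver
  open import Relation.Binary.PropositionalEquality
  open import Data.Nat.Combinatorics using (_C_; nC1≡n; k>n⇒nCk≡0; nCk+nC[k+1]≡[n+1]C[k+1])
  open import Defs
  open Rationals
  open RationalSums
  open InverseFactorials
  open ExpCauchyProduct
  open DeficitBound

  [k+1]*[n+1]C[k+1]≡[n+1]*nCk : ∀ n k → suc k ℕ.* (suc n C suc k) ≡ suc n ℕ.* (n C k)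
  [k+1]*[n+1]C[k+1]≡[n+1]*nCk zero zero = refl
  [k+1]*[n+1]C[k+1]≡[n+1]*nCk zero (suc k) = begin
      suc (suc k) ℕ.* (1 C suc (suc k))
    ≡⟨ cong (suc (suc k) ℕ.*_) (k>n⇒nCk≡0 {1} {suc (suc k)} (ℕ.s<s ℕ.z<s)) ⟩
      suc (suc k) ℕ.* 0
    ≡⟨ ℕP.*-zeroʳ (suc (suc k)) ⟩
      0
    ≡⟨ sym (cong (1 ℕ.*_) (k>n⇒nCk≡0 {0} {suc k} ℕ.z<s)) ⟩
      1 ℕ.* (0 C suc k)
    ∎
    where open ≡-Reasoning
  [k+1]*[n+1]C[k+1]≡[n+1]*nCk (suc n) zero = trans (ℕP.*-identityˡ _) (trans (nC1≡n (suc (suc n))) (sym (ℕP.*-identityʳ (suc (suc n)))))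
  [k+1]*[n+1]C[k+1]≡[n+1]*nCk (suc n) (suc k) = begin
      suc (suc k) ℕ.* (suc (suc n) C suc (suc k))
    ≡⟨ cong (suc (suc k) ℕ.*_) (sym (nCk+nC[k+1]≡[n+1]C[k+1] (suc n) (suc k))) ⟩
      suc (suc k) ℕ.* (X ℕ.+ suc n C suc (suc k))
    ≡⟨ ℕP.*-distribˡ-+ (suc (suc k)) X _ ⟩
      suc (suc k) ℕ.* X ℕ.+ suc (suc k) ℕ.* (suc n C suc (suc k))
    ≡⟨ cong₂ ℕ._+_ (cong (X ℕ.+_) ([k+1]*[n+1]C[k+1]≡[n+1]*nCk n k)) ([k+1]*[n+1]C[k+1]≡[n+1]*nCk n (suc k)) ⟩
      X ℕ.+ suc n ℕ.* (n C k) ℕ.+ suc n ℕ.* (n C suc k)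
    ≡⟨ trans (ℕP.+-assoc X _ _) (cong (X ℕ.+_) (sym (ℕP.*-distribˡ-+ (suc n) (n C k) (n C suc k)))) ⟩
      X ℕ.+ suc n ℕ.* (n C k ℕ.+ n C suc k)
    ≡⟨ cong (λ z → X ℕ.+ suc n ℕ.* z) (nCk+nC[k+1]≡[n+1]C[k+1] n k) ⟩
      suc (suc n) ℕ.* X
    ∎
    where
    open ≡-Reasoning
    X = suc n C suc k

  -- invFalling k j = (k − j)! / k! for j ≤ k, and 0 otherwise.
  invFalling : ℕ → ℕ → ℚ
  invFalling k zero = 1ℚ
  invFalling zero (suc j) = 0ℚ
  invFalling (suc k) (suc j) = invFalling k j * 1/[1+ k ]

  C*invFalling : ∀ k j → ℕtoℚ (k C suc j) * invFalling k j ≡ ℕtoℚ (k ∸ j) * invFact (suc j)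
  C*invFalling zero zero = refl
  C*invFalling zero (suc j) = sym (ℚP.*-zeroˡ (invFact (suc (suc j))))
  C*invFalling (suc m) zero = trans (ℚP.*-identityʳ _) (trans (cong ℕtoℚ (nC1≡n (suc m))) (sym (ℚP.*-identityʳ _)))
  C*invFalling (suc m) (suc j) = begin
      Bs * (invFalling m j * 1/[1+ m ])
    ≡⟨ solve 4 (λ b q ρ t → b :* (q :* ρ) := b :* (q :* ρ) :* con 1ℚ) refl Bs (invFalling m j) (1/[1+ m ]) (1/[1+ suc j ]) ⟩
      Bs * (invFalling m j * 1/[1+ m ]) * 1ℚ
    ≡⟨ cong (λ z → Bs * (invFalling m j * 1/[1+ m ]) * z) (sym (trans (ℚP.*-comm (ℕtoℚ (suc (suc j))) (1/[1+ suc j ])) (1/[1+n]*[1+n]≡1 (suc j)))) ⟩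
      Bs * (invFalling m j * 1/[1+ m ]) * (ℕtoℚ (suc (suc j)) * 1/[1+ suc j ])
    ≡⟨ solve 5 (λ b q rm t rj → b :* (q :* rm) :* (t :* rj) := (t :* b) :* q :* rm :* rj) refl Bs (invFalling m j) (1/[1+ m ]) (ℕtoℚ (suc (suc j))) (1/[1+ suc j ]) ⟩
      (ℕtoℚ (suc (suc j)) * Bs) * invFalling m j * 1/[1+ m ] * 1/[1+ suc j ]
    ≡⟨ cong (λ z → z * invFalling m j * 1/[1+ m ] * 1/[1+ suc j ]) (trans (sym (ℕtoℚ-* (suc (suc j)) (suc m C suc (suc j)))) (trans (cong ℕtoℚ ([k+1]*[n+1]C[k+1]≡[n+1]*nCk m (suc j))) (ℕtoℚ-* (suc m) (m C suc j)))) ⟩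
      (ℕtoℚ (suc m) * ℕtoℚ (m C suc j)) * invFalling m j * 1/[1+ m ] * 1/[1+ suc j ]
    ≡⟨ solve 5 (λ s b q rm rj → s :* b :* q :* rm :* rj := (rm :* s) :* (b :* q) :* rj) refl (ℕtoℚ (suc m)) (ℕtoℚ (m C suc j)) (invFalling m j) (1/[1+ m ]) (1/[1+ suc j ]) ⟩
      (1/[1+ m ] * ℕtoℚ (suc m)) * (ℕtoℚ (m C suc j) * invFalling m j) * 1/[1+ suc j ]
    ≡⟨ cong₂ (λ z w → z * w * 1/[1+ suc j ]) (1/[1+n]*[1+n]≡1 m) (C*invFalling m j) ⟩
      1ℚ * (ℕtoℚ (m ∸ j) * invFact (suc j)) * 1/[1+ suc j ]
    ≡⟨ solve 3 (λ a i rj → con 1ℚ :* (a :* i) :* rj := a :* (rj :* i)) refl (ℕtoℚ (m ∸ j)) (invFact (suc j)) (1/[1+ suc j ]) ⟩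
      ℕtoℚ (m ∸ j) * (1/[1+ suc j ] * invFact (suc j))
    ≡⟨ cong (ℕtoℚ (m ∸ j) *_) (sym (invFact-suc (suc j))) ⟩
      ℕtoℚ (m ∸ j) * invFact (suc (suc j))
    ∎
    where
    open ≡-Reasoning
    Bs = ℕtoℚ (suc m C suc (suc j))


module StaircaseMean where

  open import Data.Nat as ℕ using (ℕ; zero; suc; _!; _∸_)
  import Data.Nat.Properties as ℕP
  open import Data.Rational using (ℚ; 0ℚ; 1ℚ; _+_; _*_; _-_; -_; _≤_; _/_)
  import Data.Rational.Properties as ℚP
  open import Data.Rational.Solver
  open +-*-Solver
  open import Relation.Binary.PropositionalEquality
  open import Data.Nat.Combinatorics using (_C_; k>n⇒nCk≡0; nCk+nC[k+1]≡[n+1]C[k+1])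
  open import Defs
  open import Data.List using (length)
  open Rationals
  open RationalSums
  open InverseFactorials
  open ExpCauchyProduct
  open DeficitBound
  open FallingFactorials
  open PermutationSums using (sumPerms-const)
  open Staircase using (staircaseGain; staircaseGain-step; staircase)

  -- staircaseMean k s = Σ_{j<s} (-1)^j C(s, j+1) (k−j)!/k! solves the recursion a(m+1, s) = s − Σ_{t<s} a(m, t) / (m+1)
  -- that staircaseGain-rec gives for a(k, s) = staircaseGain k s / k!.
  staircaseTerm : ℕ → ℕ → ℕ → ℚ
  staircaseTerm k s j = sign j * ℕtoℚ (s C suc j) * invFalling k j

  staircaseMean : ℕ → ℕ → ℚ
  staircaseMean k s = sumToℚ s (staircaseTerm k s)

  pascalPart : ℕ → ℕ → ℚ
  pascalPart k s = sumToℚ (suc s) (λ j → sign j * ℕtoℚ (s C j) * invFalling k j)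

  staircaseMean-suc : ∀ k s → staircaseMean k (suc s) ≡ staircaseMean k s + pascalPart k s
  staircaseMean-suc k s = begin
      sumToℚ (suc s) (staircaseTerm k (suc s))
    ≡⟨ sumToℚ-cong (suc s) _ _ (λ j → trans (cong (λ z → sign j * ℕtoℚ z * invFalling k j) (sym (nCk+nC[k+1]≡[n+1]C[k+1] s j)))
         (trans (cong (λ z → sign j * z * invFalling k j) (ℕtoℚ-+ (s C j) (s C suc j)))
         (solve 4 (λ g a b q → g :* (a :+ b) :* q := g :* a :* q :+ g :* b :* q) refl (sign j) (ℕtoℚ (s C j)) (ℕtoℚ (s C suc j)) (invFalling k j)))) ⟩
      sumToℚ (suc s) (λ j → sign j * ℕtoℚ (s C j) * invFalling k j + staircaseTerm k s j)
    ≡⟨ sumToℚ-+ (suc s) (λ j → sign j * ℕtoℚ (s C j) * invFalling k j) (staircaseTerm k s) ⟩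
      pascalPart k s + sumToℚ (suc s) (staircaseTerm k s)
    ≡⟨ cong (pascalPart k s +_) (sumToℚ-last s (staircaseTerm k s)) ⟩
      pascalPart k s + (staircaseMean k s + staircaseTerm k s s)
    ≡⟨ cong (λ z → pascalPart k s + (staircaseMean k s + sign s * ℕtoℚ z * invFalling k s)) (k>n⇒nCk≡0 (ℕP.n<1+n s)) ⟩
      pascalPart k s + (staircaseMean k s + sign s * 0ℚ * invFalling k s)
    ≡⟨ solve 4 (λ a b g q → a :+ (b :+ g :* con 0ℚ :* q) := b :+ a) refl (pascalPart k s) (staircaseMean k s) (sign s) (invFalling k s) ⟩
      staircaseMean k s + pascalPart k s
    ∎
    where open ≡-Reasoning

  pascalPart-suc : ∀ k s → pascalPart (suc k) s ≡ 1ℚ + - (1/[1+ k ] * staircaseMean k s)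
  pascalPart-suc k s = cong (λ z → 1ℚ + z) (trans (sumToℚ-cong s _ (λ j → - (1/[1+ k ] * staircaseTerm k s j))
      (λ j → solve 4 (λ g b q rk → :- g :* b :* (q :* rk) := :- (rk :* (g :* b :* q))) refl (sign j) (ℕtoℚ (s C suc j)) (invFalling k j) (1/[1+ k ])))
    (trans (sumToℚ-neg s (λ j → 1/[1+ k ] * staircaseTerm k s j)) (cong -_ (sumToℚ-* s (1/[1+ k ]) (staircaseTerm k s)))))

  n!≡[1+n]!*1/[1+n] : ∀ m → ℕtoℚ (m !) ≡ ℕtoℚ (suc m !) * 1/[1+ m ]
  n!≡[1+n]!*1/[1+n] m = begin
      ℕtoℚ (m !)
    ≡⟨ sym (ℚP.*-identityʳ _) ⟩
      ℕtoℚ (m !) * 1ℚ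
    ≡⟨ cong (ℕtoℚ (m !) *_) (sym (1/[1+n]*[1+n]≡1 m)) ⟩
      ℕtoℚ (m !) * (1/[1+ m ] * ℕtoℚ (suc m))
    ≡⟨ solve 3 (λ f ρ s → f :* (ρ :* s) := s :* f :* ρ) refl (ℕtoℚ (m !)) (1/[1+ m ]) (ℕtoℚ (suc m)) ⟩
      ℕtoℚ (suc m) * ℕtoℚ (m !) * 1/[1+ m ]
    ≡⟨ cong (_* 1/[1+ m ]) (sym (ℕtoℚ-* (suc m) (m !))) ⟩
      ℕtoℚ (suc m !) * 1/[1+ m ]
    ∎
    where open ≡-Reasoning

  staircaseGain≡!*staircaseMean : ∀ k s → s ℕ.≤ k → ℕtoℚ (staircaseGain k s) ≡ ℕtoℚ (k !) * staircaseMean k s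
  staircaseGain≡!*staircaseMean zero zero le = refl
  staircaseGain≡!*staircaseMean (suc m) s le = inner s le
    where
    K = suc m !
    inner : ∀ s → s ℕ.≤ suc m → ℕtoℚ (staircaseGain (suc m) s) ≡ ℕtoℚ K * staircaseMean (suc m) s
    inner zero le = trans (cong ℕtoℚ (trans (sumPerms-const 0 (staircase (suc m))) (ℕP.*-zeroʳ (length (staircase (suc m)) !)))) (sym (ℚP.*-zeroʳ (ℕtoℚ K)))
    inner (suc s) le = begin
        ℕtoℚ X′
      ≡⟨ solve 3 (λ x g y → x := (x :+ g) :- g) refl (ℕtoℚ X′) (ℕtoℚ g) (ℕtoℚ X) ⟩
        (ℕtoℚ X′ + ℕtoℚ g) - ℕtoℚ g
      ≡⟨ cong (λ z → z - ℕtoℚ g) (trans (sym (ℕtoℚ-+ X′ g)) (trans (cong ℕtoℚ (staircaseGain-step m s le)) (ℕtoℚ-+ X K))) ⟩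
        (ℕtoℚ X + ℕtoℚ K) - ℕtoℚ g
      ≡⟨ cong₂ (λ z w → (z + ℕtoℚ K) - w) (inner s (ℕP.≤-trans (ℕP.n≤1+n s) le)) (trans (staircaseGain≡!*staircaseMean m s (ℕP.≤-pred le)) (cong (_* staircaseMean m s) (n!≡[1+n]!*1/[1+n] m))) ⟩
        (ℕtoℚ K * staircaseMean (suc m) s + ℕtoℚ K) - ℕtoℚ K * 1/[1+ m ] * staircaseMean m s
      ≡⟨ solve 4 (λ k a rm b → (k :* a :+ k) :- k :* rm :* b := k :* (a :+ (con 1ℚ :+ :- (rm :* b)))) refl (ℕtoℚ K) (staircaseMean (suc m) s) (1/[1+ m ]) (staircaseMean m s) ⟩
        ℕtoℚ K * (staircaseMean (suc m) s + (1ℚ + - (1/[1+ m ] * staircaseMean m s)))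
      ≡⟨ cong (λ z → ℕtoℚ K * (staircaseMean (suc m) s + z)) (sym (pascalPart-suc m s)) ⟩
        ℕtoℚ K * (staircaseMean (suc m) s + pascalPart (suc m) s)
      ≡⟨ cong (ℕtoℚ K *_) (sym (staircaseMean-suc (suc m) s)) ⟩
        ℕtoℚ K * staircaseMean (suc m) (suc s)
      ∎
      where
      open ≡-Reasoning
      X′ = staircaseGain (suc m) (suc s)
      X = staircaseGain (suc m) s
      g = staircaseGain m s

  staircaseMeanDiag : ℕ → ℚ
  staircaseMeanDiag k = sumToℚ k (λ j → sign j * ℕtoℚ (k ∸ j) * invFact (suc j))

  signedInvFactSum : ℕ → ℚ
  signedInvFactSum k = sumToℚ k (λ j → sign j * invFact (suc j))

  staircaseMean-diag : ∀ k → staircaseMean k k ≡ staircaseMeanDiag k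
  staircaseMean-diag k = sumToℚ-cong k _ _ (λ j → trans (ℚP.*-assoc (sign j) _ _) (trans (cong (sign j *_) (C*invFalling k j)) (sym (ℚP.*-assoc (sign j) _ _))))

  staircaseMeanDiag-suc : ∀ k → staircaseMeanDiag (suc k) ≡ staircaseMeanDiag k + signedInvFactSum (suc k)
  staircaseMeanDiag-suc k = begin
      sumToℚ (suc k) (λ j → sign j * ℕtoℚ (suc k ∸ j) * invFact (suc j))
    ≡⟨ sumToℚ-last k _ ⟩
      sumToℚ k (λ j → sign j * ℕtoℚ (suc k ∸ j) * invFact (suc j)) + sign k * ℕtoℚ (suc k ∸ k) * invFact (suc k)
    ≡⟨ cong₂ _+_ (sumToℚ-cong-< k _ (λ j → sign j * (1ℚ + ℕtoℚ (k ∸ j)) * invFact (suc j))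
          (λ j lt → cong (λ z → sign j * z * invFact (suc j)) (trans (cong ℕtoℚ (ℕP.+-∸-assoc 1 (ℕP.<⇒≤ lt))) (ℕtoℚ-+ 1 (k ∸ j)))))
         (cong (λ z → sign k * ℕtoℚ z * invFact (suc k)) (ℕP.m+n∸n≡m 1 k)) ⟩
      sumToℚ k (λ j → sign j * (1ℚ + ℕtoℚ (k ∸ j)) * invFact (suc j)) + sign k * 1ℚ * invFact (suc k)
    ≡⟨ cong₂ _+_ (trans (sumToℚ-cong k _ _ (λ j → solve 3 (λ g a i → g :* (con 1ℚ :+ a) :* i := g :* a :* i :+ g :* i) refl (sign j) (ℕtoℚ (k ∸ j)) (invFact (suc j))))
                   (sumToℚ-+ k (λ j → sign j * ℕtoℚ (k ∸ j) * invFact (suc j)) (λ j → sign j * invFact (suc j))))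
                 (solve 2 (λ g i → g :* con 1ℚ :* i := g :* i) refl (sign k) (invFact (suc k))) ⟩
      (staircaseMeanDiag k + signedInvFactSum k) + sign k * invFact (suc k)
    ≡⟨ trans (ℚP.+-assoc (staircaseMeanDiag k) (signedInvFactSum k) _) (cong (staircaseMeanDiag k +_) (sym (sumToℚ-last k (λ j → sign j * invFact (suc j))))) ⟩
      staircaseMeanDiag k + signedInvFactSum (suc k)
    ∎
    where open ≡-Reasoning

  eInvApprox≡1-signedInvFactSum : ∀ k → eInvApprox k ≡ 1ℚ + - signedInvFactSum k
  eInvApprox≡1-signedInvFactSum k = cong (λ z → 1ℚ + z) (trans (sumToℚ-cong k _ _ (λ i → solve 2 (λ g x → :- g :* x := :- (g :* x)) refl (sign i) (invFact (suc i))))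
    (sumToℚ-neg k (λ i → sign i * invFact (suc i))))

  k-staircaseMeanDiag≡deficit : ∀ k → ℕtoℚ k - staircaseMeanDiag k ≡ deficit k
  k-staircaseMeanDiag≡deficit zero = refl
  k-staircaseMeanDiag≡deficit (suc k) = begin
      ℕtoℚ (suc k) - staircaseMeanDiag (suc k)
    ≡⟨ cong₂ _-_ (ℕtoℚ-+ 1 k) (staircaseMeanDiag-suc k) ⟩
      (1ℚ + ℕtoℚ k) - (staircaseMeanDiag k + signedInvFactSum (suc k))
    ≡⟨ solve 3 (λ n v w → (con 1ℚ :+ n) :- (v :+ w) := (n :- v) :+ (con 1ℚ :+ :- w)) refl (ℕtoℚ k) (staircaseMeanDiag k) (signedInvFactSum (suc k)) ⟩
      (ℕtoℚ k - staircaseMeanDiag k) + (1ℚ + - signedInvFactSum (suc k))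
    ≡⟨ cong₂ _+_ (k-staircaseMeanDiag≡deficit k) (sym (eInvApprox≡1-signedInvFactSum (suc k))) ⟩
      deficit k + eInvApprox (suc k)
    ∎
    where open ≡-Reasoning

  k-staircaseMean≡deficit : ∀ k → ℕtoℚ k - ℕtoℚ (staircaseGain k k) * invFact k ≡ deficit k
  k-staircaseMean≡deficit k = trans (cong (λ z → ℕtoℚ k - z) mean) (trans (cong (λ z → ℕtoℚ k - z) (staircaseMean-diag k)) (k-staircaseMeanDiag≡deficit k))
    where
    mean : ℕtoℚ (staircaseGain k k) * invFact k ≡ staircaseMean k k
    mean = trans (cong (_* invFact k) (staircaseGain≡!*staircaseMean k k ℕP.≤-refl))
      (trans (solve 3 (λ f a i → f :* a :* i := a :* (i :* f)) refl (ℕtoℚ (k !)) (staircaseMean k k) (invFact k))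
        (trans (cong (staircaseMean k k *_) (invFact*! k)) (ℚP.*-identityʳ (staircaseMean k k))))


module UniRandAboveStaircase where

  open import Data.Nat as ℕ using (ℕ; _!)
  import Data.Nat.Properties as ℕP
  open import Data.List using (List; _++_; length; map; catMaybes; allFin)
  open import Data.List.Properties using (length-tabulate; length-map; map-++; take-all)
  import Data.List.Relation.Unary.All as All
  open import Data.List.Membership.Propositional.Properties using (∈-allFin)
  open import Data.List.Relation.Unary.Unique.Propositional.Properties using (allFin⁺)
  import Data.List.Relation.Binary.Permutation.Propositional as Perm
  import Data.List.Relation.Binary.Permutation.Propositional.Properties as PermP
  open import Data.Product using (_,_; proj₁; proj₂)
  open import Data.Rational using (0ℚ; _+_; _*_; _≤_)
  import Data.Rational.Properties as ℚP
  open import Data.Rational.Solver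
  open +-*-Solver
  open import Relation.Binary.PropositionalEquality
  open import Defs
  open PermutationSums
  open Greedy
  open Staircase using (staircaseGain; staircase; length-upFrom)
  open ItemLists
  open Lifetimes
  open GreedyRecursion
  open UniRandAsGreedy
  open Rationals
  open InverseFactorials

  uniRandExpectedGain≡totalGreedy : ∀ {n} (del : DecInstance n) big → n ℕ.≤ big →
    uniRandExpectedGain del ≡ ℕtoℚ (totalGreedy del big 0 (allFin n)) * invFact n
  uniRandExpectedGain≡totalGreedy {n} del big n≤big = begin
      E
    ≡⟨ solve 1 (λ e → e := e :+ con 0ℚ) refl E ⟩
      E + 0ℚ
    ≡⟨ sym (trans (cong (_* (E + 0ℚ)) (invFact*! n)) (ℚP.*-identityˡ _)) ⟩
      (invFact n * ℕtoℚ (n !)) * (E + 0ℚ)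
    ≡⟨ solve 3 (λ i f e → (i :* f) :* e := (f :* e) :* i) refl (invFact n) (ℕtoℚ (n !)) (E + 0ℚ) ⟩
      (ℕtoℚ (n !) * (E + 0ℚ)) * invFact n
    ≡⟨ cong (_* invFact n) bridge ⟩
      ℕtoℚ (totalGreedy del big 0 (allFin n)) * invFact n
    ∎
    where
    open ≡-Reasoning
    E = uniRandExpectedGain del
    lengthAll : length (allFin n) ≡ n
    lengthAll = length-tabulate (λ i → i)
    bridge : ℕtoℚ (n !) * (E + ℕtoℚ 0) ≡ ℕtoℚ (totalGreedy del big 0 (allFin n))
    bridge = subst (λ z → ℕtoℚ (z !) * (E + ℕtoℚ 0) ≡ ℕtoℚ (totalGreedy del big 0 (allFin n))) lengthAll
      (uniRand≡averageGreedy del big n 0 (allFin n) (allFin⁺ n) (ℕP.≤-reflexive lengthAll)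
        (ℕP.≤-trans (ℕP.≤-reflexive lengthAll) n≤big))

  -- The items collected by σ have lifetimes dominating 1, 2, …, g, and the other items only raise the average.
  staircaseGain≤totalGreedy : ∀ {n} (del : DecInstance n) σ → Feasible del σ →
    staircaseGain (gain σ) (gain σ) ℕ.* n ! ℕ.≤ totalGreedy del (n ℕ.+ length σ) 0 (allFin n) ℕ.* gain σ !
  staircaseGain≤totalGreedy {n} del σ (schedule , unique) = begin
      staircaseGain g g ℕ.* n !
    ≡⟨ cong (ℕ._* n !) takeAll ⟩
      sumPerms (greedy 0) (staircase g) ℕ.* n !
    ≤⟨ ℕP.*-monoˡ-≤ (n !) raise ⟩
      sumPerms (greedy 0) (map ℓ C) ℕ.* n !
    ≡⟨ cong (λ z → sumPerms (greedy 0) (map ℓ C) ℕ.* z !) (sym lengthAll) ⟩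
      sumPerms (greedy 0) (map ℓ C) ℕ.* length (map ℓ rest ++ map ℓ C) !
    ≤⟨ sumPerms-greedy-++-≥ 0 (map ℓ rest) (map ℓ C) ⟩
      sumPerms (greedy 0) (map ℓ rest ++ map ℓ C) ℕ.* length (map ℓ C) !
    ≡⟨ cong₂ (λ z w → z ℕ.* w !) (sym (sumPerms-↭ (greedy 0) all↭)) (length-map ℓ C) ⟩
      totalGreedy del big 0 (allFin n) ℕ.* g !
    ∎
    where
    open ℕP.≤-Reasoning
    g = gain σ
    big = n ℕ.+ length σ
    ℓ = lifetime del big
    C = catMaybes σ
    takeAll : staircaseGain g g ≡ sumPerms (greedy 0) (staircase g)
    takeAll = sumPerms-cong-length _ _ (staircase g) (λ τ e → cong (greedy 0) (take-all g τ (ℕP.≤-reflexive (trans e (length-upFrom 1 g)))))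
    raise : sumPerms (greedy 0) (staircase g) ℕ.≤ sumPerms (greedy 0) (map ℓ C)
    raise = sumPerms-mono-Pointwise (greedy 0) (greedy 0) (feasible⇒staircase≤lifetimes del big 0 σ schedule (ℕP.m≤n+m (length σ) n))
      (λ τ τ′ τ≤τ′ → greedy-mono ℕP.≤-refl τ≤τ′)
    complement = ↭-complement C (allFin n) unique (allFin⁺ n) (All.tabulate (λ {i} _ → ∈-allFin i))
    rest = proj₁ complement
    all↭ : map ℓ (allFin n) Perm.↭ (map ℓ rest ++ map ℓ C)
    all↭ = Perm.trans (PermP.map⁺ ℓ (proj₂ complement))
      (subst (Perm._↭ (map ℓ rest ++ map ℓ C)) (sym (map-++ ℓ C rest)) (PermP.++-comm (map ℓ C) (map ℓ rest)))
    lengthAll : length (map ℓ rest ++ map ℓ C) ≡ n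
    lengthAll = trans (sym (PermP.↭-length all↭)) (trans (length-map ℓ (allFin n)) (length-tabulate (λ i → i)))

  staircaseMean≤uniRand : ∀ {n} (del : DecInstance n) σ → Feasible del σ →
    ℕtoℚ (staircaseGain (gain σ) (gain σ)) * invFact (gain σ) ≤ uniRandExpectedGain del
  staircaseMean≤uniRand {n} del σ feasible =
    subst₂ _≤_ lhs rhs (*-monoʳ-≤-0≤ (0≤-* (0≤invFact n) (0≤invFact g)) (ℕtoℚ-mono-≤ (staircaseGain≤totalGreedy del σ feasible)))
    where
    g = gain σ
    A = staircaseGain g g
    T = totalGreedy del (n ℕ.+ length σ) 0 (allFin n)
    lhs : ℕtoℚ (A ℕ.* n !) * (invFact n * invFact g) ≡ ℕtoℚ A * invFact g
    lhs = trans (cong (_* (invFact n * invFact g)) (ℕtoℚ-* A (n !)))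
      (trans (solve 4 (λ x f i j → x :* f :* (i :* j) := x :* j :* (i :* f)) refl (ℕtoℚ A) (ℕtoℚ (n !)) (invFact n) (invFact g))
        (trans (cong (ℕtoℚ A * invFact g *_) (invFact*! n)) (ℚP.*-identityʳ _)))
    rhs : ℕtoℚ (T ℕ.* g !) * (invFact n * invFact g) ≡ uniRandExpectedGain del
    rhs = trans (cong (_* (invFact n * invFact g)) (ℕtoℚ-* T (g !)))
      (trans (solve 4 (λ x f i j → x :* f :* (i :* j) := x :* i :* (j :* f)) refl (ℕtoℚ T) (ℕtoℚ (g !)) (invFact n) (invFact g))
        (trans (cong (ℕtoℚ T * invFact n *_) (invFact*! g))
          (trans (ℚP.*-identityʳ _) (sym (uniRandExpectedGain≡totalGreedy del (n ℕ.+ length σ) (ℕP.m≤m+n n (length σ)))))))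


open import Data.Rational using (_-_; _*_)
open import Data.Rational.Properties using (module ≤-Reasoning; +-monoʳ-≤; neg-antimono-≤; *-comm)
open import Relation.Binary.PropositionalEquality using (cong)
open Staircase using (staircaseGain)
open Rationals using (*-monoʳ-≤-0≤)
open InverseFactorials using (invFact)
open DeficitBound using (0≤eApprox; deficit; eApprox*deficit≤)
open StaircaseMean using (k-staircaseMean≡deficit)
open UniRandAboveStaircase using (staircaseMean≤uniRand)

theorem2 : (n : ℕ) (del : DecInstance n) (σ : List (Maybe (Fin n))) →
    Feasible del σ →
    AtLeastOverEOverEMinus1 (uniRandExpectedGain del) (ℕtoℚ (gain σ))
theorem2 n del σ feasible N = begin
    (ℕtoℚ g - uniRandExpectedGain del) * eApprox N
  ≤⟨ *-monoʳ-≤-0≤ (0≤eApprox N) (+-monoʳ-≤ (ℕtoℚ g) (neg-antimono-≤ (staircaseMean≤uniRand del σ feasible))) ⟩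
    (ℕtoℚ g - ℕtoℚ (staircaseGain g g) * invFact g) * eApprox N
  ≡⟨ cong (_* eApprox N) (k-staircaseMean≡deficit g) ⟩
    deficit g * eApprox N
  ≡⟨ *-comm (deficit g) (eApprox N) ⟩
    eApprox N * deficit g
  ≤⟨ eApprox*deficit≤ N g ⟩
    ℕtoℚ g
  ∎
  where
  open ≤-Reasoning
  g = gain σ
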